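{- For any symmetric function $f$, we have $T_n(f(\Xi_n)) \in Z(\mathbb{C}[S_n])$; that is, the transitive image of any symmetric function evaluated at the Jucys-Murphy elements is central in the group algebra of $S_n$.
   Context: Let $n$ be a positive integer, $S_n$ the symmetric group on $[n]=\{1,\dots,n\}$ (permutations multiplied from left to right), $\mathbb{C}[S_n]$ its group algebra and $Z(\mathbb{C}[S_n])$ the centre of the group algebra. The Jucys-Murphy elements are $J_1 = 0$ and $J_k = (1\,k)+(2\,k)+\dots+(k-1\,k) \in \mathbb{C}[S_n]$ for $2 \le k \le n$; they pairwise commute. For a symmetric function $f$ (in variables $x_1,x_2,\dots$), $f(\Xi_n)$ denotes the evaluation $f(J_1,\dots,J_n,0,0,\dots)$. A set $\{\sigma_1,\dots,\sigma_t\}\subseteq S_n$ acts transitively on $[n]$ if the subgroup it generates has a single orbit on $[n]$. The transitivity operator $T_n$ is defined on products of permutations by $T_n(\tau_1\tau_2\cdots\tau_t)=\tau_1\tau_2\cdots\tau_t$ if $\{\tau_1,\dots,\tau_t\}$ acts transitively on $[n]$, and $T_n(\tau_1\cdots\tau_t)=0$ otherwise, and it is extended linearly to formal sums of products of transpositions; in particular $T_n(f(\Xi_n))$ is obtained by expanding $f(\Xi_n)$ as a sum of products of transpositions $(a\,b)$ coming from the Jucys-Murphy elements and keeping exactly those products whose factors act transitively on $[n]$. ($T_n$ is linear but not multiplicative.) -}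

module Defs where

open import Level using (Level; _⊔_)
open import Data.Nat as ℕ using (ℕ; zero; suc; _>_)
open import Data.Fin using (Fin; toℕ; _≟_)
open import Data.Fin.Properties using (all?)
open import Data.Fin.Permutation using (Permutation′; _⟨$⟩ʳ_; _⟨$⟩ˡ_; _∘ₚ_; transpose)
import Data.Fin.Permutation as Perm
open import Data.List as List using (List; []; _∷_; _++_; map; concatMap; foldr; filter; upTo; allFin)
open import Data.List.Membership.Propositional using (_∈_)
open import Data.Nat.ListAction renaming (sum to sumℕ)
open import Data.Vec as Vec using (Vec; lookup; tabulate; toList)
open import Data.Product using (_×_; _,_; proj₁; proj₂)
open import Relation.Nullary using (Dec; yes; no)
open import Relation.Unary using (Decidable)
open import Algebra.Bundles using (CommutativeRing)
open import Relation.Binary.PropositionalEquality using (_≡_)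

-- Permutations of [n] = Fin n.  Product is LEFT-TO-RIGHT:
-- (σ ∘ₚ τ) ⟨$⟩ʳ i = τ ⟨$⟩ʳ (σ ⟨$⟩ʳ i), i.e. σ is applied first.

Sym : ℕ → Set
Sym n = Permutation′ n

prod : ∀ {n} → List (Sym n) → Sym n
prod []       = Perm.id
prod (σ ∷ σs) = σ ∘ₚ prod σs

_≟ₚ_ : ∀ {n} (σ τ : Sym n) → Dec (∀ i → σ ⟨$⟩ʳ i ≡ τ ⟨$⟩ʳ i)
σ ≟ₚ τ = all? (λ i → (σ ⟨$⟩ʳ i) ≟ (τ ⟨$⟩ʳ i))

-- Reach S x y  ⇔  y = x·g for some g ∈ ⟨S⟩
-- (elements of ⟨S⟩ are products of elements of S and their inverses).

data Reach {n} (S : List (Sym n)) (x : Fin n) : Fin n → Set where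
  here : Reach S x x
  step : ∀ {y g} → Reach S x y → g ∈ S → Reach S x (g ⟨$⟩ʳ y)
  stepInv : ∀ {y g} → Reach S x y → g ∈ S → Reach S x (g ⟨$⟩ˡ y)

ActsTransitively : ∀ n → List (Sym n) → Set
ActsTransitively n S = ∀ (x y : Fin n) → Reach S x y

Transp : ℕ → Set
Transp n = Fin n × Fin n

toPerm : ∀ {n} → Transp n → Sym n
toPerm (a , b) = transpose a b

-- formal sums of words:  product of formal sums of words
_⊗_ : ∀ {A : Set} → List (List A) → List (List A) → List (List A)
xs ⊗ ys = concatMap (λ u → map (u ++_) ys) xs

pow : ∀ {A : Set} → List A → ℕ → List (List A)
pow X zero    = [] ∷ []
pow X (suc a) = pow X a ⊗ map (λ t → t ∷ []) X

-- Jucys–Murphy element J_k = (1 k) + ⋯ + (k-1 k), as a formal sum of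
-- transpositions (i k) with i < k; J_1 is the empty sum 0.
JM : ∀ n → Fin n → List (Transp n)
JM n k = map (λ i → (i , k)) (filter (λ i → toℕ i ℕ.<? toℕ k) (allFin n))

monoWords : ∀ n → Vec ℕ n → List (List (Transp n))
monoWords n α = foldr _⊗_ ([] ∷ []) (map (λ k → pow (JM n k) (lookup α k)) (allFin n))

vecsUpTo : ∀ n → ℕ → List (Vec ℕ n)
vecsUpTo zero    d = Vec.[] ∷ []
vecsUpTo (suc n) d = concatMap (λ a → map (a Vec.∷_) (vecsUpTo n d)) (upTo (suc d))

-- Everything over a commutative coefficient ring R (ℂ in the paper).

module Over {c ℓ : Level} (R : CommutativeRing c ℓ) where
  open CommutativeRing R renaming (Carrier to K)

  Σ : List K → K
  Σ = foldr _+_ 0#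

  -- Symmetric functions in x₁, x₂, … over R: formal power series of
  -- bounded degree invariant under permutations of the variables.
  -- A monomial x₁^{α₁} x₂^{α₂} ⋯ (finite support) is represented by the
  -- list [α₁, …, αₘ]; trailing zeros are irrelevant.

  record SymFun : Set (c ⊔ ℓ) where
    field
      coeff  : List ℕ → K
      degree : ℕ
      coeff-pad : ∀ α → coeff (α ++ (0 ∷ [])) ≈ coeff α
      coeff-deg : ∀ α → sumℕ α > degree → coeff α ≈ 0#
      coeff-sym : ∀ m (α : Vec ℕ m) (π : Sym m) →
                  coeff (toList (tabulate (λ i → lookup α (π ⟨$⟩ʳ i)))) ≈ coeff (toList α)
  open SymFun public

  FormalSum : ℕ → Set c
  FormalSum n = List (K × List (Transp n))

  -- f(Ξ_n) = f(J₁, …, Jₙ, 0, 0, …) expanded as a formal sum of products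
  -- of transpositions: Σ_α coeff f α · J₁^{α₁} ⋯ Jₙ^{αₙ} (monomials in
  -- the variables x_{n+1}, … vanish; monomials of degree > deg f have
  -- coefficient 0, so restricting to entries ≤ deg f loses nothing).
  evalJM : ∀ n → SymFun → FormalSum n
  evalJM n f = concatMap (λ α → map (λ w → (coeff f (toList α) , w)) (monoWords n α))
                         (vecsUpTo n (degree f))

  GA : ℕ → Set c
  GA n = List (K × Sym n)

  coeffGA : ∀ {n} → GA n → Sym n → K
  coeffGA x π = Σ (map proj₁ (filter (λ t → proj₂ t ≟ₚ π) x))

  _≈GA_ : ∀ {n} → GA n → GA n → Set ℓ
  x ≈GA y = ∀ π → coeffGA x π ≈ coeffGA y π

  _·_ : ∀ {n} → GA n → GA n → GA n
  x · y = concatMap (λ s → map (λ t → (proj₁ s * proj₁ t , proj₂ s ∘ₚ proj₂ t)) y) x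

  Central : ∀ {n} → GA n → Set (c ⊔ ℓ)
  Central x = ∀ y → (x · y) ≈GA (y · x)

  -- It is parametrised by a decision procedure for transitivity (any two
  -- such procedures give the same result).

  T : ∀ n → (∀ S → Dec (ActsTransitively n S)) → FormalSum n → GA n
  T n dec e = map (λ t → (proj₁ t , prod (map toPerm (proj₂ t))))
                  (filter (λ t → dec (map toPerm (proj₂ t))) e)

{-# OPTIONS --safe #-}
module Submission where

open import Defs
open import Level using (Level; 0ℓ)
open import Algebra.Bundles using (Monoid; CommutativeMonoid; Semiring; CommutativeRing)
open import Algebra.Definitions using (RightCancellative)
import Algebra.Properties.CommutativeMonoid.Sum as VectorSum
import Algebra.Properties.CommutativeSemigroup as CommSemigroupProperties
import Algebra.Properties.Monoid.Mult as Mult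
import Algebra.Properties.Semiring.Exp as Exp
import Algebra.Solver.CommutativeMonoid as CommutativeMonoidSolver
open import Data.Bool as Bool using (Bool; true; false; if_then_else_; _∧_)
open import Data.Fin using (Fin; zero; suc; toℕ) renaming (_≟_ to _≟ᶠ_)
open import Data.Fin.Properties using (suc-injective; toℕ-injective)
open import Data.Fin.Permutation as Perm
  using (_⟨$⟩ʳ_; _⟨$⟩ˡ_; _∘ₚ_; transpose; lift₀; remove; inverseˡ; inverseʳ;
         lift₀-id; lift₀-comp; lift₀-cong; lift₀-transpose; lift₀-remove)
  renaming (_≈_ to _≈ₚ_)
open import Data.Fin.Permutation.Components using () renaming (transpose to τ)
open import Data.List as List using (List; []; _∷_; _++_; map; concatMap; filter; foldr; allFin; upTo)
open import Data.List.Membership.Propositional using (_∈_)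
open import Data.List.Membership.Propositional.Properties
  using (∈-++⁺ˡ; ∈-++⁺ʳ; ∈-++⁻; ∈-map⁺; ∈-map⁻; ∈-filter⁻)
open import Data.List.Properties
  using (++-assoc; ++-identityʳ; map-++; map-∘; map-tabulate; map-cong-local; concatMap-++;
         filter-++; filter-all; filter-none; filter-accept)
open import Data.List.Relation.Unary.All as All using (All; []; _∷_)
open import Data.List.Relation.Unary.All.Properties using (tabulate⁺; map⁺)
open import Data.List.Relation.Unary.Any using (here; there)
open import Data.Nat as ℕ using (ℕ; zero; suc; _<_; _≤_; _∸_; z≤n; s≤s; _<ᵇ_; _≡ᵇ_; ⌊_/2⌋)
import Data.Nat.Properties as ℕ
open import Data.Product using (_×_; _,_; proj₁; proj₂; Σ-syntax)
open import Data.Sum using (inj₁; inj₂)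
open import Data.Vec as Vec using (Vec; []; _∷_; lookup; toList)
open import Data.Vec.Properties using (lookup∘tabulate; tabulate∘lookup; tabulate-cong)
open import Function using (_∘_; _⇔_; mk⇔)
open import Function.Construct.Composition using (_⇔-∘_)
open import Function.Construct.Symmetry using (⇔-sym)
open import Relation.Binary using (IsEquivalence)
open import Relation.Binary.PropositionalEquality as ≡ using (_≡_; _≢_; refl; cong; cong₂)
open import Relation.Nullary using (Dec; does; yes; no; ¬_)
open import Relation.Nullary.Decidable using (does-⇔; dec-true; dec-false)

-- Call two formal sums E, F of words of transpositions equivalent, E ≋ F, when for
-- every pair of words l, r and every π they contain equally many words w for which l w r acts
-- transitively with product π.  Two words with the same product whose letters generate the same
-- partition of [n] are interchangeable in any context, so ≋ is a congruence: formal sums form a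
-- semiring modulo ≋, in which coefficients of T(f(Ξₙ)) can be read off.
--
-- Fix adjacent p, q = p + 1 and s = (p q).  Modulo ≋, conjugation by s fixes every Jₖ with
-- k ≠ p, q, while Jₚ and J_q commute and their sum and product are s-invariant.  For a commuting
-- pair, every Jₚᵃ J_qᵇ + Jₚᵇ J_qᵃ is a polynomial in the sum and the product (Newton's identities,
-- with cancellation of + standing in for subtraction), so it is s-invariant too.  As f is
-- symmetric, pairing each exponent vector with the one in which α_p and α_q are exchanged shows
-- that the coefficients of T(f(Ξₙ)) are invariant under conjugation by s.  Adjacent
-- transpositions generate Sₙ, so T(f(Ξₙ)) is a class function, hence central.

-- Finite sums and products

module ListSum {c ℓ} (M : CommutativeMonoid c ℓ) where
  open CommutativeMonoid M
    renaming (Carrier to C; _∙_ to _+_; ε to 0#; ∙-cong to +-cong; ∙-congˡ to +-congˡ; refl to ≈-refl)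
  open CommSemigroupProperties commutativeSemigroup using (interchange)
  open VectorSum M using (sum; ∑-permute)

  ∑ : ∀ {a} {A : Set a} → List A → (A → C) → C
  ∑ []       g = 0#
  ∑ (x ∷ xs) g = g x + ∑ xs g

  module _ {a} {A : Set a} where

    ∑-cong : ∀ (xs : List A) {g h : A → C} → (∀ x → g x ≈ h x) → ∑ xs g ≈ ∑ xs h
    ∑-cong []       g≈h = ≈-refl
    ∑-cong (x ∷ xs) g≈h = +-cong (g≈h x) (∑-cong xs g≈h)

    ∑-cong-∈ : ∀ (xs : List A) {g h : A → C} → (∀ {x} → x ∈ xs → g x ≈ h x) →
               ∑ xs g ≈ ∑ xs h
    ∑-cong-∈ []       g≈h = ≈-refl
    ∑-cong-∈ (x ∷ xs) g≈h = +-cong (g≈h (here refl)) (∑-cong-∈ xs (g≈h ∘ there))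

    ∑-++ : ∀ (xs ys : List A) (g : A → C) → ∑ (xs ++ ys) g ≈ ∑ xs g + ∑ ys g
    ∑-++ []       ys g = sym (identityˡ _)
    ∑-++ (x ∷ xs) ys g = trans (+-congˡ (∑-++ xs ys g)) (sym (assoc _ _ _))

    ∑-zero : ∀ (xs : List A) → ∑ xs (λ _ → 0#) ≈ 0#
    ∑-zero []       = ≈-refl
    ∑-zero (x ∷ xs) = trans (identityˡ _) (∑-zero xs)

    ∑-distrib-+ : ∀ (xs : List A) (g h : A → C) → ∑ xs (λ x → g x + h x) ≈ ∑ xs g + ∑ xs h
    ∑-distrib-+ []       g h = sym (identityˡ 0#)
    ∑-distrib-+ (x ∷ xs) g h = trans (+-congˡ (∑-distrib-+ xs g h)) (interchange _ _ _ _)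

    ∑-filter : ∀ {p} {P : A → Set p} (P? : ∀ x → Dec (P x)) xs (g : A → C) →
               ∑ (filter P? xs) g ≈ ∑ xs (λ x → if does (P? x) then g x else 0#)
    ∑-filter P? []       g = ≈-refl
    ∑-filter P? (x ∷ xs) g with P? x
    ... | yes _ = +-congˡ (∑-filter P? xs g)
    ... | no _  = trans (∑-filter P? xs g) (sym (identityˡ _))

  module _ {a b} {A : Set a} {B : Set b} where

    ∑-map : ∀ (f : A → B) xs (g : B → C) → ∑ (map f xs) g ≡ ∑ xs (g ∘ f)
    ∑-map f []       g = refl
    ∑-map f (x ∷ xs) g = cong (g (f x) +_) (∑-map f xs g)

    ∑-concatMap : ∀ (f : A → List B) xs (g : B → C) →
                  ∑ (concatMap f xs) g ≈ ∑ xs (λ x → ∑ (f x) g)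
    ∑-concatMap f []       g = ≈-refl
    ∑-concatMap f (x ∷ xs) g = trans (∑-++ (f x) (concatMap f xs) g) (+-congˡ (∑-concatMap f xs g))

    ∑-comm : ∀ (xs : List A) (ys : List B) (g : A → B → C) →
             ∑ xs (λ x → ∑ ys (g x)) ≈ ∑ ys (λ y → ∑ xs (λ x → g x y))
    ∑-comm []       ys g = sym (∑-zero ys)
    ∑-comm (x ∷ xs) ys g = trans (+-congˡ (∑-comm xs ys g)) (sym (∑-distrib-+ ys (g x) _))

  ∑-tabulate : ∀ {a} {A : Set a} {n} (f : Fin n → A) (g : A → C) →
               ∑ (List.tabulate f) g ≈ sum (g ∘ f)
  ∑-tabulate {n = zero}  f g = ≈-refl
  ∑-tabulate {n = suc n} f g = +-congˡ (∑-tabulate (f ∘ Fin.suc) g)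

  ∑-allFin-permute : ∀ {n} (σ : Sym n) (g : Fin n → C) → ∑ (allFin n) (g ∘ (σ ⟨$⟩ʳ_)) ≈ ∑ (allFin n) g
  ∑-allFin-permute σ g = begin
    ∑ (allFin _) (g ∘ (σ ⟨$⟩ʳ_))  ≈⟨ ∑-tabulate (λ i → i) (g ∘ (σ ⟨$⟩ʳ_)) ⟩
    sum (g ∘ (σ ⟨$⟩ʳ_))            ≈⟨ ∑-permute g σ ⟨
    sum g                          ≈⟨ ∑-tabulate (λ i → i) g ⟨
    ∑ (allFin _) g                 ∎
    where open import Relation.Binary.Reasoning.Setoid setoid

module ListProduct {c ℓ} (M : Monoid c ℓ) where
  open Monoid M renaming (refl to ≈-refl)

  product : ∀ {a} {A : Set a} → List A → (A → Carrier) → Carrier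
  product xs g = foldr _∙_ ε (map g xs)

  module _ {a} {A : Set a} where

    product-++ : ∀ (xs ys : List A) (g : A → Carrier) →
                 product (xs ++ ys) g ≈ product xs g ∙ product ys g
    product-++ []       ys g = sym (identityˡ _)
    product-++ (x ∷ xs) ys g = trans (∙-congˡ (product-++ xs ys g)) (sym (assoc _ _ _))

    product-cong-∈ : ∀ (xs : List A) {g h : A → Carrier} → (∀ {x} → x ∈ xs → g x ≈ h x) →
                     product xs g ≈ product xs h
    product-cong-∈ []       g≈h = ≈-refl
    product-cong-∈ (x ∷ xs) g≈h = ∙-cong (g≈h (here refl)) (product-cong-∈ xs (g≈h ∘ there))

-- Transpositions and the generation of Sₙ

module _ {n : ℕ} where

  τ-matchˡ : ∀ (u v : Fin n) → τ u v u ≡ v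
  τ-matchˡ u v rewrite dec-true (u ≟ᶠ u) refl = refl

  τ-matchʳ : ∀ (u v : Fin n) → τ u v v ≡ u
  τ-matchʳ u v with v ≟ᶠ u
  ... | yes refl = refl
  ... | no v≢u rewrite dec-true (v ≟ᶠ v) refl = refl

  τ-fix : ∀ {u v x : Fin n} → x ≢ u → x ≢ v → τ u v x ≡ x
  τ-fix {u} {v} {x} x≢u x≢v rewrite dec-false (x ≟ᶠ u) x≢u | dec-false (x ≟ᶠ v) x≢v = refl

  data TranspositionView (u v x : Fin n) : Set where
    at-u  : x ≡ u → TranspositionView u v x
    at-v  : x ≢ u → x ≡ v → TranspositionView u v x
    fixed : x ≢ u → x ≢ v → TranspositionView u v x

  transpositionView : ∀ u v x → TranspositionView u v x
  transpositionView u v x with x ≟ᶠ u | x ≟ᶠ v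
  ... | yes x≡u | _       = at-u x≡u
  ... | no x≢u  | yes x≡v = at-v x≢u x≡v
  ... | no x≢u  | no x≢v  = fixed x≢u x≢v

  τ-involutive : ∀ (u v x : Fin n) → τ u v (τ u v x) ≡ x
  τ-involutive u v x with transpositionView u v x
  ... | at-u refl     = ≡.trans (cong (τ u v) (τ-matchˡ u v)) (τ-matchʳ u v)
  ... | at-v _ refl   = ≡.trans (cong (τ u v) (τ-matchʳ u v)) (τ-matchˡ u v)
  ... | fixed x≢u x≢v = ≡.trans (cong (τ u v) (τ-fix x≢u x≢v)) (τ-fix x≢u x≢v)

  τ-comm : ∀ (u v x : Fin n) → τ u v x ≡ τ v u x
  τ-comm u v x with transpositionView u v x
  ... | at-u refl     = ≡.trans (τ-matchˡ u v) (≡.sym (τ-matchʳ v u))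
  ... | at-v _ refl   = ≡.trans (τ-matchʳ u v) (≡.sym (τ-matchˡ v u))
  ... | fixed x≢u x≢v = ≡.trans (τ-fix x≢u x≢v) (≡.sym (τ-fix x≢v x≢u))

  τ-injective : ∀ (u v : Fin n) {x y} → τ u v x ≡ τ u v y → x ≡ y
  τ-injective u v {x} {y} e =
    ≡.trans (≡.sym (τ-involutive u v x)) (≡.trans (cong (τ u v) e) (τ-involutive u v y))

  ∘ₚ-flipʳ-⇔ : ∀ (σ ρ π : Sym n) → σ ∘ₚ ρ ≈ₚ π ⇔ σ ≈ₚ π ∘ₚ Perm.flip ρ
  ∘ₚ-flipʳ-⇔ σ ρ π = mk⇔ (λ e i → ≡.trans (≡.sym (inverseˡ ρ)) (cong (ρ ⟨$⟩ˡ_) (e i)))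
                         (λ e i → ≡.trans (cong (ρ ⟨$⟩ʳ_) (e i)) (inverseʳ ρ))

  ∘ₚ-flipˡ-⇔ : ∀ (σ ρ π : Sym n) → ρ ∘ₚ σ ≈ₚ π ⇔ σ ≈ₚ Perm.flip ρ ∘ₚ π
  ∘ₚ-flipˡ-⇔ σ ρ π = mk⇔ (λ e j → ≡.trans (cong (σ ⟨$⟩ʳ_) (≡.sym (inverseʳ ρ))) (e (ρ ⟨$⟩ˡ j)))
                         (λ e i → ≡.trans (e (ρ ⟨$⟩ʳ i)) (cong (π ⟨$⟩ʳ_) (inverseˡ ρ)))

τ-conj : ∀ {m n} (f : Fin m → Fin n) → (∀ {a b} → f a ≡ f b → a ≡ b) →
         ∀ u v x → τ (f u) (f v) (f x) ≡ f (τ u v x)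
τ-conj f f-inj u v x with transpositionView u v x
... | at-u refl     = ≡.trans (τ-matchˡ (f u) (f v)) (cong f (≡.sym (τ-matchˡ u v)))
... | at-v _ refl   = ≡.trans (τ-matchʳ (f u) (f v)) (cong f (≡.sym (τ-matchʳ u v)))
... | fixed x≢u x≢v = ≡.trans (τ-fix (x≢u ∘ f-inj) (x≢v ∘ f-inj)) (cong f (≡.sym (τ-fix x≢u x≢v)))

Adjacent : ∀ {n} → Fin n → Fin n → Set
Adjacent p q = toℕ q ≡ suc (toℕ p)

module _ {a} {A : Set a} where

  swapAt : ∀ {n} → Fin n → Fin n → Vec A n → Vec A n
  swapAt p q α = Vec.tabulate (λ i → lookup α (transpose p q ⟨$⟩ʳ i))

  lookup-swapAt : ∀ {n} (p q : Fin n) (α : Vec A n) k → lookup (swapAt p q α) k ≡ lookup α (τ p q k)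
  lookup-swapAt p q α = lookup∘tabulate (λ i → lookup α (τ p q i))

  swapAt-01 : ∀ {n} (x y : A) (γ : Vec A n) → swapAt zero (suc zero) (x ∷ y ∷ γ) ≡ y ∷ x ∷ γ
  swapAt-01 x y γ = cong (λ δ → y ∷ x ∷ δ) (tabulate∘lookup γ)

  swapAt-suc : ∀ {n} (p q : Fin n) x (β : Vec A n) → swapAt (suc p) (suc q) (x ∷ β) ≡ x ∷ swapAt p q β
  swapAt-suc p q x β =
    cong (x ∷_) (tabulate-cong (λ i → cong (lookup (x ∷ β)) (τ-conj suc suc-injective p q i)))

  swapAt-fixed : ∀ {n} (p q : Fin n) (α : Vec A n) → lookup α p ≡ lookup α q → swapAt p q α ≡ α
  swapAt-fixed p q α αp≡αq = ≡.trans (tabulate-cong same) (tabulate∘lookup α)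
    where
    same : ∀ i → lookup α (τ p q i) ≡ lookup α i
    same i with transpositionView p q i
    ... | at-u refl     = ≡.trans (cong (lookup α) (τ-matchˡ p q)) (≡.sym αp≡αq)
    ... | at-v _ refl   = ≡.trans (cong (lookup α) (τ-matchʳ p q)) αp≡αq
    ... | fixed i≢p i≢q = cong (lookup α) (τ-fix i≢p i≢q)

record AdjacentClosed {n ℓ} (P : Sym n → Set ℓ) : Set ℓ where
  field
    resp        : ∀ {σ ρ} → σ ≈ₚ ρ → P σ → P ρ
    identity    : P Perm.id
    ∘ₚ-closed   : ∀ {σ ρ} → P σ → P ρ → P (σ ∘ₚ ρ)
    flip-closed : ∀ {σ} → P σ → P (Perm.flip σ)
    adjacent    : ∀ p q → Adjacent p q → P (transpose p q)

module _ {ℓ : Level} where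
  open AdjacentClosed

  lift₀-closed : ∀ {n} {P : Sym (suc n) → Set ℓ} → AdjacentClosed P → AdjacentClosed (P ∘ lift₀)
  lift₀-closed cl = record
    { resp        = λ {σ} {ρ} σ≈ρ → resp cl (lift₀-cong σ ρ σ≈ρ)
    ; identity    = resp cl (≡.sym ∘ lift₀-id) (identity cl)
    ; ∘ₚ-closed   = λ {σ} {ρ} Pσ Pρ → resp cl (lift₀-comp σ ρ) (∘ₚ-closed cl Pσ Pρ)
    ; flip-closed = λ Pσ → resp cl flip-lift₀ (flip-closed cl Pσ)
    ; adjacent    = λ p q p~q → resp cl (lift₀-transpose p q) (adjacent cl (suc p) (suc q) (cong suc p~q))
    }
    where
    flip-lift₀ : ∀ {σ : Sym _} → Perm.flip (lift₀ σ) ≈ₚ lift₀ (Perm.flip σ)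
    flip-lift₀ zero    = refl
    flip-lift₀ (suc i) = refl

  moveToZero : ∀ {n} {P : Sym (suc n) → Set ℓ} → AdjacentClosed P →
               ∀ j → Σ[ h ∈ Sym (suc n) ] P h × h ⟨$⟩ʳ j ≡ zero
  moveToZero cl zero = Perm.id , identity cl , refl
  moveToZero {suc n} cl (suc j) with moveToZero (lift₀-closed cl) j
  ... | h , Ph , hj≡0 = lift₀ h ∘ₚ transpose zero (suc zero)
                      , ∘ₚ-closed cl Ph (adjacent cl zero (suc zero) refl)
                      , cong (τ zero (suc zero) ∘ suc) hj≡0

  adjacentClosed⇒all : ∀ {n} {P : Sym n → Set ℓ} → AdjacentClosed P → ∀ σ → P σ
  adjacentClosed⇒all {zero}  cl σ = resp cl (λ ()) (identity cl)
  adjacentClosed⇒all {suc n} {P} cl σ with moveToZero cl (σ ⟨$⟩ʳ zero)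
  ... | h , Ph , hσ0≡0 = resp cl undo-h (∘ₚ-closed cl Pσh (flip-closed cl Ph))
    where
    Pσh : P (σ ∘ₚ h)
    Pσh = resp cl (lift₀-remove (σ ∘ₚ h) hσ0≡0)
                  (adjacentClosed⇒all (lift₀-closed cl) (remove zero (σ ∘ₚ h)))
    undo-h : (σ ∘ₚ h) ∘ₚ Perm.flip h ≈ₚ σ
    undo-h i = inverseˡ h

-- Sums over exponent vectors

module ExponentSums {c ℓ} (M : CommutativeMonoid c ℓ) where
  open CommutativeMonoid M
    renaming (Carrier to C; _∙_ to _+_; ε to 0#; ∙-cong to +-cong; ∙-congˡ to +-congˡ; ∙-congʳ to +-congʳ;
              refl to ≈-refl)
  open ListSum M
  open import Relation.Binary.Reasoning.Setoid setoid

  ∑-vecsUpTo-suc : ∀ n d (h : Vec ℕ (suc n) → C) →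
                   ∑ (vecsUpTo (suc n) d) h ≈ ∑ (upTo (suc d)) (λ a → ∑ (vecsUpTo n d) (λ β → h (a ∷ β)))
  ∑-vecsUpTo-suc n d h = trans (∑-concatMap (λ a → map (a ∷_) (vecsUpTo n d)) (upTo (suc d)) h)
                               (∑-cong (upTo (suc d)) λ a → reflexive (∑-map (a ∷_) (vecsUpTo n d) h))

  ∑-vecsUpTo-swapAt : ∀ {n} (p q : Fin n) → Adjacent p q → ∀ d (h : Vec ℕ n → C) →
                      ∑ (vecsUpTo n d) (h ∘ swapAt p q) ≈ ∑ (vecsUpTo n d) h
  ∑-vecsUpTo-swapAt {suc (suc n)} zero (suc zero) refl d h = begin
    ∑ (vecsUpTo (suc (suc n)) d) (h ∘ swapAt zero (suc zero))
      ≈⟨ trans (∑-vecsUpTo-suc (suc n) d _) (∑-cong U λ a → ∑-vecsUpTo-suc n d _) ⟩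
    ∑ U (λ a → ∑ U (λ b → ∑ V (λ γ → h (swapAt zero (suc zero) (a ∷ b ∷ γ)))))
      ≈⟨ ∑-cong U (λ a → ∑-cong U λ b → ∑-cong V λ γ → reflexive (cong h (swapAt-01 a b γ))) ⟩
    ∑ U (λ a → ∑ U (λ b → ∑ V (λ γ → h (b ∷ a ∷ γ))))
      ≈⟨ ∑-comm U U _ ⟩
    ∑ U (λ b → ∑ U (λ a → ∑ V (λ γ → h (b ∷ a ∷ γ))))
      ≈⟨ trans (∑-vecsUpTo-suc (suc n) d h) (∑-cong U λ b → ∑-vecsUpTo-suc n d _) ⟨
    ∑ (vecsUpTo (suc (suc n)) d) h ∎
    where
    U = upTo (suc d)
    V = vecsUpTo n d
  ∑-vecsUpTo-swapAt {suc n} (suc p) (suc q) p~q d h = begin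
    ∑ (vecsUpTo (suc n) d) (h ∘ swapAt (suc p) (suc q))
      ≈⟨ ∑-vecsUpTo-suc n d _ ⟩
    ∑ U (λ a → ∑ V (λ β → h (swapAt (suc p) (suc q) (a ∷ β))))
      ≈⟨ ∑-cong U (λ a → ∑-cong V λ β → reflexive (cong h (swapAt-suc p q a β))) ⟩
    ∑ U (λ a → ∑ V (λ β → h (a ∷ swapAt p q β)))
      ≈⟨ ∑-cong U (λ a → ∑-vecsUpTo-swapAt p q (ℕ.suc-injective p~q) d (h ∘ (a ∷_))) ⟩
    ∑ U (λ a → ∑ V (λ β → h (a ∷ β)))
      ≈⟨ ∑-vecsUpTo-suc n d h ⟨
    ∑ (vecsUpTo (suc n) d) h ∎
    where
    U = upTo (suc d)
    V = vecsUpTo n d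

  trichotomy : ∀ a b x →
               x ≈ (if b <ᵇ a then x else 0#) + ((if a <ᵇ b then x else 0#) + (if a ≡ᵇ b then x else 0#))
  trichotomy zero    zero    x = sym (trans (identityˡ _) (identityˡ x))
  trichotomy zero    (suc b) x = sym (trans (identityˡ _) (identityʳ x))
  trichotomy (suc a) zero    x = sym (trans (+-congˡ (identityˡ 0#)) (identityʳ x))
  trichotomy (suc a) (suc b) x = trichotomy a b x

  if-cong : ∀ b {x y} → (Bool.T b → x ≈ y) → (if b then x else 0#) ≈ (if b then y else 0#)
  if-cong true  x≈y = x≈y _
  if-cong false x≈y = ≈-refl

  if-+ : ∀ b x y → (if b then x else 0#) + (if b then y else 0#) ≈ (if b then x + y else 0#)
  if-+ true  x y = ≈-refl
  if-+ false x y = identityˡ 0#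

  module _ {n : ℕ} (p q : Fin n) (p~q : Adjacent p q) (d : ℕ) where

    -- each orbit {α, swapAt p q α} of size two is represented by its member with α p > α q
    orbitTerm : (Vec ℕ n → C) → Vec ℕ n → C
    orbitTerm h α = (if lookup α q <ᵇ lookup α p then h α + h (swapAt p q α) else 0#)
                  + (if lookup α p ≡ᵇ lookup α q then h α else 0#)

    ∑-orbits : ∀ (h : Vec ℕ n → C) → ∑ (vecsUpTo n d) h ≈ ∑ (vecsUpTo n d) (orbitTerm h)
    ∑-orbits h = begin
      ∑ V h
        ≈⟨ ∑-cong V (λ α → trichotomy (lookup α p) (lookup α q) (h α)) ⟩
      ∑ V (λ α → gt α (h α) + (lt α (h α) + eq α))
        ≈⟨ trans (∑-distrib-+ V _ _) (+-congˡ (∑-distrib-+ V _ _)) ⟩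
      ∑ V (λ α → gt α (h α)) + (∑ V (λ α → lt α (h α)) + ∑ V eq)
        ≈⟨ +-congˡ (+-congʳ (trans (sym (∑-vecsUpTo-swapAt p q p~q d (λ α → lt α (h α)))) (∑-cong V lt∘swap))) ⟩
      ∑ V (λ α → gt α (h α)) + (∑ V (λ α → gt α (h (swapAt p q α))) + ∑ V eq)
        ≈⟨ trans (sym (assoc _ _ _)) (+-congʳ (sym (∑-distrib-+ V _ _))) ⟩
      ∑ V (λ α → gt α (h α) + gt α (h (swapAt p q α))) + ∑ V eq
        ≈⟨ sym (∑-distrib-+ V _ _) ⟩
      ∑ V (λ α → gt α (h α) + gt α (h (swapAt p q α)) + eq α)
        ≈⟨ ∑-cong V (λ α → +-congʳ (if-+ _ (h α) (h (swapAt p q α)))) ⟩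
      ∑ V (orbitTerm h) ∎
      where
      V = vecsUpTo n d
      gt lt : Vec ℕ n → C → C
      gt α x = if lookup α q <ᵇ lookup α p then x else 0#
      lt α x = if lookup α p <ᵇ lookup α q then x else 0#
      eq : Vec ℕ n → C
      eq α = if lookup α p ≡ᵇ lookup α q then h α else 0#
      lt∘swap : ∀ α → lt (swapAt p q α) (h (swapAt p q α)) ≈ gt α (h (swapAt p q α))
      lt∘swap α = reflexive (cong (λ b → if b then h (swapAt p q α) else 0#)
        (cong₂ _<ᵇ_ (≡.trans (lookup-swapAt p q α p) (cong (lookup α) (τ-matchˡ p q)))
                    (≡.trans (lookup-swapAt p q α q) (cong (lookup α) (τ-matchʳ p q)))))

    ∑-swapAt-invariant : ∀ (h h′ : Vec ℕ n → C) →
                         (∀ α → h α + h (swapAt p q α) ≈ h′ α + h′ (swapAt p q α)) →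
                         (∀ α → swapAt p q α ≡ α → h α ≈ h′ α) →
                         ∑ (vecsUpTo n d) h ≈ ∑ (vecsUpTo n d) h′
    ∑-swapAt-invariant h h′ on-orbits on-fixed =
      trans (∑-orbits h) (trans (∑-cong (vecsUpTo n d) same) (sym (∑-orbits h′)))
      where
      same : ∀ α → orbitTerm h α ≈ orbitTerm h′ α
      same α = +-cong (if-cong (lookup α q <ᵇ lookup α p) (λ _ → on-orbits α))
                      (if-cong (lookup α p ≡ᵇ lookup α q)
                               (λ αp≡αq → on-fixed α (swapAt-fixed p q α (ℕ.≡ᵇ⇒≡ _ _ αp≡αq))))

-- The group algebra

module GroupAlgebra {c ℓ} (R : CommutativeRing c ℓ) where
  open CommutativeRing R renaming (Carrier to K; refl to ≈-refl)
  open Over R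
  open ListSum +-commutativeMonoid
  open import Relation.Binary.Reasoning.Setoid setoid

  pick : ∀ {n} → Sym n → K × Sym n → K
  pick π t = if does (proj₂ t ≟ₚ π) then proj₁ t else 0#

  pick-⇔ : ∀ {n} (σ π σ′ π′ : Sym n) a → σ ≈ₚ π ⇔ σ′ ≈ₚ π′ → pick π (a , σ) ≡ pick π′ (a , σ′)
  pick-⇔ σ π σ′ π′ a σ≈π⇔σ′≈π′ =
    cong (λ b → if b then a else 0#) (does-⇔ σ≈π⇔σ′≈π′ (σ ≟ₚ π) (σ′ ≟ₚ π′))

  coeffGA≈∑ : ∀ {n} (x : GA n) π → coeffGA x π ≈ ∑ x (pick π)
  coeffGA≈∑ x π = trans (reflexive (Σ∘map (filter (λ t → proj₂ t ≟ₚ π) x)))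
                        (∑-filter (λ t → proj₂ t ≟ₚ π) x proj₁)
    where
    Σ∘map : ∀ {n} (ys : GA n) → Σ (map proj₁ ys) ≡ ∑ ys proj₁
    Σ∘map []       = refl
    Σ∘map (y ∷ ys) = cong (proj₁ y +_) (Σ∘map ys)

  coeffGA-resp : ∀ {n} (x : GA n) π π′ → π ≈ₚ π′ → coeffGA x π ≈ coeffGA x π′
  coeffGA-resp x π π′ π≈π′ = begin
    coeffGA x π    ≈⟨ coeffGA≈∑ x π ⟩
    ∑ x (pick π)   ≈⟨ ∑-cong x (λ t → reflexive (pick-⇔ (proj₂ t) π (proj₂ t) π′ (proj₁ t) (mk⇔ (to {proj₂ t}) (from {proj₂ t})))) ⟩
    ∑ x (pick π′)  ≈⟨ coeffGA≈∑ x π′ ⟨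
    coeffGA x π′   ∎
    where
    to : ∀ {σ : Sym _} → σ ≈ₚ π → σ ≈ₚ π′
    to e i = ≡.trans (e i) (π≈π′ i)
    from : ∀ {σ : Sym _} → σ ≈ₚ π′ → σ ≈ₚ π
    from e i = ≡.trans (e i) (≡.sym (π≈π′ i))

  module _ {a} {A : Set a} where

    ∑-*ʳ : ∀ (xs : List A) (g : A → K) y → ∑ xs (λ z → g z * y) ≈ ∑ xs g * y
    ∑-*ʳ []       g y = sym (zeroˡ y)
    ∑-*ʳ (x ∷ xs) g y = trans (+-congˡ (∑-*ʳ xs g y)) (sym (distribʳ y _ _))

    ∑-*ˡ : ∀ (xs : List A) (g : A → K) y → ∑ xs (λ z → y * g z) ≈ y * ∑ xs g
    ∑-*ˡ []       g y = sym (zeroʳ y)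
    ∑-*ˡ (x ∷ xs) g y = trans (+-congˡ (∑-*ˡ xs g y)) (sym (distribˡ y _ _))

  if-*ʳ : ∀ b x y → (if b then x * y else 0#) ≈ (if b then x else 0#) * y
  if-*ʳ true  x y = ≈-refl
  if-*ʳ false x y = sym (zeroˡ y)

  if-*ˡ : ∀ b x y → (if b then y * x else 0#) ≈ y * (if b then x else 0#)
  if-*ˡ true  x y = ≈-refl
  if-*ˡ false x y = sym (zeroʳ y)

  module _ {n : ℕ} (x : GA n) where

    coeffGA-·ʳ : ∀ y π → coeffGA (x · y) π ≈ ∑ y (λ t → coeffGA x (π ∘ₚ Perm.flip (proj₂ t)) * proj₁ t)
    coeffGA-·ʳ y π = begin
      coeffGA (x · y) π
        ≈⟨ coeffGA≈∑ (x · y) π ⟩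
      ∑ (x · y) (pick π)
        ≈⟨ ∑-concatMap _ x (pick π) ⟩
      ∑ x (λ s → ∑ (map (λ t → (proj₁ s * proj₁ t , proj₂ s ∘ₚ proj₂ t)) y) (pick π))
        ≈⟨ ∑-cong x (λ s → reflexive (∑-map _ y (pick π))) ⟩
      ∑ x (λ s → ∑ y (λ t → pick π (proj₁ s * proj₁ t , proj₂ s ∘ₚ proj₂ t)))
        ≈⟨ ∑-cong x (λ s → ∑-cong y (λ t → move s t)) ⟩
      ∑ x (λ s → ∑ y (λ t → pick (π ∘ₚ Perm.flip (proj₂ t)) s * proj₁ t))
        ≈⟨ ∑-comm x y _ ⟩
      ∑ y (λ t → ∑ x (λ s → pick (π ∘ₚ Perm.flip (proj₂ t)) s * proj₁ t))
        ≈⟨ ∑-cong y (λ t → trans (∑-*ʳ x (pick (π ∘ₚ Perm.flip (proj₂ t))) (proj₁ t))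
                                 (*-congʳ (sym (coeffGA≈∑ x (π ∘ₚ Perm.flip (proj₂ t)))))) ⟩
      ∑ y (λ t → coeffGA x (π ∘ₚ Perm.flip (proj₂ t)) * proj₁ t)
        ∎
      where
      move : ∀ (s t : K × Sym n) → pick π (proj₁ s * proj₁ t , proj₂ s ∘ₚ proj₂ t) ≈
                                   pick (π ∘ₚ Perm.flip (proj₂ t)) s * proj₁ t
      move (a , σ) (b , ρ) =
        trans (reflexive (pick-⇔ (σ ∘ₚ ρ) π σ (π ∘ₚ Perm.flip ρ) (a * b) (∘ₚ-flipʳ-⇔ σ ρ π))) (if-*ʳ _ a b)

    coeffGA-·ˡ : ∀ y π → coeffGA (y · x) π ≈ ∑ y (λ t → proj₁ t * coeffGA x (Perm.flip (proj₂ t) ∘ₚ π))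
    coeffGA-·ˡ y π = begin
      coeffGA (y · x) π
        ≈⟨ coeffGA≈∑ (y · x) π ⟩
      ∑ (y · x) (pick π)
        ≈⟨ ∑-concatMap _ y (pick π) ⟩
      ∑ y (λ t → ∑ (map (λ s → (proj₁ t * proj₁ s , proj₂ t ∘ₚ proj₂ s)) x) (pick π))
        ≈⟨ ∑-cong y (λ t → reflexive (∑-map _ x (pick π))) ⟩
      ∑ y (λ t → ∑ x (λ s → pick π (proj₁ t * proj₁ s , proj₂ t ∘ₚ proj₂ s)))
        ≈⟨ ∑-cong y (λ t → ∑-cong x (λ s → move s t)) ⟩
      ∑ y (λ t → ∑ x (λ s → proj₁ t * pick (Perm.flip (proj₂ t) ∘ₚ π) s))
        ≈⟨ ∑-cong y (λ t → trans (∑-*ˡ x (pick (Perm.flip (proj₂ t) ∘ₚ π)) (proj₁ t))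
                                 (*-congˡ (sym (coeffGA≈∑ x (Perm.flip (proj₂ t) ∘ₚ π))))) ⟩
      ∑ y (λ t → proj₁ t * coeffGA x (Perm.flip (proj₂ t) ∘ₚ π))
        ∎
      where
      move : ∀ (s t : K × Sym n) → pick π (proj₁ t * proj₁ s , proj₂ t ∘ₚ proj₂ s) ≈
                                   proj₁ t * pick (Perm.flip (proj₂ t) ∘ₚ π) s
      move (a , σ) (b , ρ) =
        trans (reflexive (pick-⇔ (ρ ∘ₚ σ) π σ (Perm.flip ρ ∘ₚ π) (b * a) (∘ₚ-flipˡ-⇔ σ ρ π))) (if-*ˡ _ a b)

    Invariant : Sym n → Set ℓ
    Invariant σ = ∀ π → coeffGA x (σ ∘ₚ π ∘ₚ Perm.flip σ) ≈ coeffGA x π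

    invariant-resp : ∀ {σ σ′} → σ ≈ₚ σ′ → Invariant σ → Invariant σ′
    invariant-resp {σ} {σ′} σ≈σ′ invσ π =
      trans (coeffGA-resp x (σ′ ∘ₚ π ∘ₚ Perm.flip σ′) (σ ∘ₚ π ∘ₚ Perm.flip σ) conj≈) (invσ π)
      where
      σ′⁻¹≈σ⁻¹ : ∀ j → σ′ ⟨$⟩ˡ j ≡ σ ⟨$⟩ˡ j
      σ′⁻¹≈σ⁻¹ j = ≡.trans (≡.sym (inverseˡ σ)) (cong (σ ⟨$⟩ˡ_) (≡.trans (σ≈σ′ (σ′ ⟨$⟩ˡ j)) (inverseʳ σ′)))
      conj≈ : σ′ ∘ₚ π ∘ₚ Perm.flip σ′ ≈ₚ σ ∘ₚ π ∘ₚ Perm.flip σ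
      conj≈ i = ≡.trans (σ′⁻¹≈σ⁻¹ (π ⟨$⟩ʳ (σ′ ⟨$⟩ʳ i))) (cong (λ j → σ ⟨$⟩ˡ (π ⟨$⟩ʳ j)) (≡.sym (σ≈σ′ i)))

    invariant-id : Invariant Perm.id
    invariant-id π = coeffGA-resp x (Perm.id ∘ₚ π ∘ₚ Perm.flip Perm.id) π (λ _ → refl)

    invariant-∘ₚ : ∀ {σ ρ} → Invariant σ → Invariant ρ → Invariant (σ ∘ₚ ρ)
    invariant-∘ₚ {σ} {ρ} invσ invρ π = begin
      coeffGA x ((σ ∘ₚ ρ) ∘ₚ π ∘ₚ Perm.flip (σ ∘ₚ ρ))
        ≈⟨ coeffGA-resp x ((σ ∘ₚ ρ) ∘ₚ π ∘ₚ Perm.flip (σ ∘ₚ ρ)) (σ ∘ₚ ρπρ⁻¹ ∘ₚ Perm.flip σ) (λ _ → refl) ⟩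
      coeffGA x (σ ∘ₚ ρπρ⁻¹ ∘ₚ Perm.flip σ)   ≈⟨ invσ ρπρ⁻¹ ⟩
      coeffGA x ρπρ⁻¹                         ≈⟨ invρ π ⟩
      coeffGA x π                             ∎
      where ρπρ⁻¹ = ρ ∘ₚ π ∘ₚ Perm.flip ρ

    invariant-flip : ∀ {σ} → Invariant σ → Invariant (Perm.flip σ)
    invariant-flip {σ} invσ π = begin
      coeffGA x (Perm.flip σ ∘ₚ π ∘ₚ Perm.flip (Perm.flip σ))
        ≈⟨ coeffGA-resp x (Perm.flip σ ∘ₚ π ∘ₚ Perm.flip (Perm.flip σ)) σ⁻¹πσ (λ _ → refl) ⟩
      coeffGA x σ⁻¹πσ
        ≈⟨ invσ σ⁻¹πσ ⟨
      coeffGA x (σ ∘ₚ σ⁻¹πσ ∘ₚ Perm.flip σ)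
        ≈⟨ coeffGA-resp x (σ ∘ₚ σ⁻¹πσ ∘ₚ Perm.flip σ) π (λ i → ≡.trans (inverseˡ σ) (cong (π ⟨$⟩ʳ_) (inverseˡ σ))) ⟩
      coeffGA x π ∎
      where σ⁻¹πσ = Perm.flip σ ∘ₚ π ∘ₚ σ

    invariant-adjacentClosed : (∀ p q → Adjacent p q → Invariant (transpose p q)) →
                               AdjacentClosed Invariant
    invariant-adjacentClosed adj = record
      { resp        = λ {σ} {ρ} → invariant-resp {σ} {ρ}
      ; identity    = invariant-id
      ; ∘ₚ-closed   = λ {σ} {ρ} → invariant-∘ₚ {σ} {ρ}
      ; flip-closed = λ {σ} → invariant-flip {σ}
      ; adjacent    = adj
      }

    classFunction⇒central : (∀ σ → Invariant σ) → Central x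
    classFunction⇒central inv y π = begin
      coeffGA (x · y) π
        ≈⟨ coeffGA-·ʳ y π ⟩
      ∑ y (λ t → coeffGA x (π ∘ₚ Perm.flip (proj₂ t)) * proj₁ t)
        ≈⟨ ∑-cong y (λ t → trans (*-comm _ _) (*-congˡ (conj t))) ⟩
      ∑ y (λ t → proj₁ t * coeffGA x (Perm.flip (proj₂ t) ∘ₚ π))
        ≈⟨ coeffGA-·ˡ y π ⟨
      coeffGA (y · x) π
        ∎
      where
      conj : ∀ t → coeffGA x (π ∘ₚ Perm.flip (proj₂ t)) ≈ coeffGA x (Perm.flip (proj₂ t) ∘ₚ π)
      conj (_ , σ) = trans (coeffGA-resp x (π ∘ₚ Perm.flip σ) (σ ∘ₚ (Perm.flip σ ∘ₚ π) ∘ₚ Perm.flip σ)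
                                         (λ i → cong (λ j → σ ⟨$⟩ˡ (π ⟨$⟩ʳ j)) (≡.sym (inverseˡ σ))))
                           (inv σ (Perm.flip σ ∘ₚ π))

-- Words of transpositions

Word : ℕ → Set
Word n = List (Transp n)

letters : ∀ {A : Set} → List A → List (List A)
letters = map (_∷ [])

module _ {n : ℕ} where

  act : Transp n → Fin n → Fin n
  act t = τ (proj₁ t) (proj₂ t)

  run : Word n → Fin n → Fin n
  run []      x = x
  run (t ∷ w) x = run w (act t x)

  prod-toPerm : ∀ (w : Word n) x → prod (map toPerm w) ⟨$⟩ʳ x ≡ run w x
  prod-toPerm []      x = refl
  prod-toPerm (t ∷ w) x = prod-toPerm w (act t x)

  run-++ : ∀ (u w : Word n) x → run (u ++ w) x ≡ run w (run u x)
  run-++ []      w x = refl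
  run-++ (t ∷ u) w x = run-++ u w (act t x)

  data Linked (w : Word n) (x : Fin n) : Fin n → Set where
    here : Linked w x x
    step : ∀ {y t} → Linked w x y → t ∈ w → Linked w x (act t y)

  module _ {w : Word n} where

    Linked-trans : ∀ {x y z} → Linked w x y → Linked w y z → Linked w x z
    Linked-trans x~y here            = x~y
    Linked-trans x~y (step y~z t∈w) = step (Linked-trans x~y y~z) t∈w

    Linked-≡ : ∀ {x y z} → Linked w x y → y ≡ z → Linked w x z
    Linked-≡ x~y refl = x~y

    Linked-sym : ∀ {x y} → Linked w x y → Linked w y x
    Linked-sym here = here
    Linked-sym (step {y = y} {t} x~y t∈w) =
      Linked-trans (Linked-≡ (step here t∈w) (τ-involutive (proj₁ t) (proj₂ t) y)) (Linked-sym x~y)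

    edge : ∀ {t} → t ∈ w → Linked w (proj₁ t) (proj₂ t)
    edge {t} t∈w = Linked-≡ (step here t∈w) (τ-matchˡ (proj₁ t) (proj₂ t))

  Linked-mono : ∀ {w w′ : Word n} → (∀ {t} → t ∈ w → t ∈ w′) → ∀ {x y} → Linked w x y → Linked w′ x y
  Linked-mono w⊆w′ here           = here
  Linked-mono w⊆w′ (step x~y t∈w) = step (Linked-mono w⊆w′ x~y) (w⊆w′ t∈w)

  Linked-edges : ∀ {w w′ : Word n} → (∀ {t} → t ∈ w → Linked w′ (proj₁ t) (proj₂ t)) →
                 ∀ {x y} → Linked w x y → Linked w′ x y
  Linked-edges edges here = here
  Linked-edges edges (step {y = y} {t} x~y t∈w) with transpositionView (proj₁ t) (proj₂ t) y
  ... | at-u refl     = Linked-trans (Linked-edges edges x~y)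
                                     (Linked-≡ (edges t∈w) (≡.sym (τ-matchˡ (proj₁ t) (proj₂ t))))
  ... | at-v _ refl   = Linked-trans (Linked-edges edges x~y)
                                     (Linked-≡ (Linked-sym (edges t∈w)) (≡.sym (τ-matchʳ (proj₁ t) (proj₂ t))))
  ... | fixed y≢u y≢v = Linked-≡ (Linked-edges edges x~y) (≡.sym (τ-fix y≢u y≢v))

  Connects : Word n → Set
  Connects w = ∀ x y → Linked w x y

  transitive⇔connects : ∀ (w : Word n) → ActsTransitively n (map toPerm w) ⇔ Connects w
  transitive⇔connects w = mk⇔ (λ tr x y → fromReach (tr x y)) (λ c x y → toReach (c x y))
    where
    fromReach : ∀ {x y} → Reach (map toPerm w) x y → Linked w x y
    fromReach here = here
    fromReach (step r g∈w) with ∈-map⁻ toPerm g∈w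
    ... | t , t∈w , refl = step (fromReach r) t∈w
    fromReach (stepInv {y = y} r g∈w) with ∈-map⁻ toPerm g∈w
    ... | t , t∈w , refl = Linked-≡ (step (fromReach r) t∈w) (τ-comm (proj₁ t) (proj₂ t) y)
    toReach : ∀ {x y} → Linked w x y → Reach (map toPerm w) x y
    toReach here           = here
    toReach (step x~y t∈w) = step (toReach x~y) (∈-map⁺ toPerm t∈w)

  infix 4 _≃_
  record _≃_ (w w′ : Word n) : Set where
    field
      edgesʳ : ∀ {t} → t ∈ w → Linked w′ (proj₁ t) (proj₂ t)
      edgesˡ : ∀ {t} → t ∈ w′ → Linked w (proj₁ t) (proj₂ t)
      run-≡  : ∀ x → run w x ≡ run w′ x
  open _≃_

  ≃-context : ∀ {w w′ : Word n} → w ≃ w′ → ∀ l r → l ++ w ++ r ≃ l ++ w′ ++ r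
  ≃-context {w} {w′} w≃w′ l r = record
    { edgesʳ = edges (edgesʳ w≃w′)
    ; edgesˡ = edges (edgesˡ w≃w′)
    ; run-≡  = λ x → begin
        run (l ++ w ++ r) x       ≡⟨ ≡.trans (run-++ l (w ++ r) x) (run-++ w r _) ⟩
        run r (run w (run l x))   ≡⟨ cong (run r) (run-≡ w≃w′ _) ⟩
        run r (run w′ (run l x))  ≡⟨ ≡.trans (run-++ l (w′ ++ r) x) (run-++ w′ r _) ⟨
        run (l ++ w′ ++ r) x      ∎
    }
    where
    open ≡.≡-Reasoning
    edges : ∀ {u u′} → (∀ {t} → t ∈ u → Linked u′ (proj₁ t) (proj₂ t)) →
            ∀ {t} → t ∈ l ++ u ++ r → Linked (l ++ u′ ++ r) (proj₁ t) (proj₂ t)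
    edges {u} {u′} u-edges t∈ with ∈-++⁻ l t∈
    ... | inj₁ t∈l = edge (∈-++⁺ˡ t∈l)
    ... | inj₂ t∈ with ∈-++⁻ u t∈
    ...   | inj₁ t∈u = Linked-mono (∈-++⁺ʳ l ∘ ∈-++⁺ˡ) (u-edges t∈u)
    ...   | inj₂ t∈r = edge (∈-++⁺ʳ l (∈-++⁺ʳ u′ t∈r))

  ≃-flip : ∀ (a b : Fin n) → (a , b) ∷ [] ≃ (b , a) ∷ []
  ≃-flip a b = record
    { edgesʳ = λ { (here refl) → Linked-sym (edge (here refl)) }
    ; edgesˡ = λ { (here refl) → Linked-sym (edge (here refl)) }
    ; run-≡  = τ-comm a b
    }

  ≃-slide : ∀ (a b c d : Fin n) → (a , b) ∷ (τ a b c , τ a b d) ∷ [] ≃ (c , d) ∷ (a , b) ∷ []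
  ≃-slide a b c d = record
    { edgesʳ = λ { (here refl)         → edge (there (here refl))
                 ; (there (here refl)) → Linked-trans (Linked-sym (viaʳ c)) (Linked-trans (edge (here refl)) (viaʳ d))
                 }
    ; edgesˡ = λ { (here refl)         → Linked-trans (viaˡ c) (Linked-trans (edge (there (here refl))) (Linked-sym (viaˡ d)))
                 ; (there (here refl)) → edge (here refl)
                 }
    ; run-≡  = τ-conj (τ a b) (τ-injective a b) c d
    }
    where
    viaʳ : ∀ x → Linked ((c , d) ∷ (a , b) ∷ []) x (τ a b x)
    viaʳ x = step here (there (here refl))
    viaˡ : ∀ x → Linked ((a , b) ∷ (τ a b c , τ a b d) ∷ []) x (τ a b x)
    viaˡ x = step here (here refl)

-- Counting transitive words

module Counting {n : ℕ} (dec : ∀ S → Dec (ActsTransitively n S)) where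
  open ListSum ℕ.+-0-commutativeMonoid
  open import Data.Nat using (_+_)
  open _≃_

  WordSum : Set
  WordSum = List (Word n)

  ind : Word n → Sym n → ℕ
  ind w π = if does (dec (map toPerm w)) ∧ does (prod (map toPerm w) ≟ₚ π) then 1 else 0

  ind-⇔ : ∀ (w w′ : Word n) (π π′ : Sym n) → Connects w ⇔ Connects w′ →
          (∀ x → run w x ≡ π ⟨$⟩ʳ x) ⇔ (∀ x → run w′ x ≡ π′ ⟨$⟩ʳ x) → ind w π ≡ ind w′ π′
  ind-⇔ w w′ π π′ connects⇔ run⇔ = cong₂ (λ b c → if b ∧ c then 1 else 0)
    (does-⇔ (⇔-sym (transitive⇔connects w′) ⇔-∘ (connects⇔ ⇔-∘ transitive⇔connects w))
            (dec (map toPerm w)) (dec (map toPerm w′)))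
    (does-⇔ (⇔-sym (prod⇔run w′ π′) ⇔-∘ (run⇔ ⇔-∘ prod⇔run w π))
            (prod (map toPerm w) ≟ₚ π) (prod (map toPerm w′) ≟ₚ π′))
    where
    prod⇔run : ∀ w π → prod (map toPerm w) ≈ₚ π ⇔ (∀ x → run w x ≡ π ⟨$⟩ʳ x)
    prod⇔run w π = mk⇔ (λ e x → ≡.trans (≡.sym (prod-toPerm w x)) (e x))
                       (λ e x → ≡.trans (prod-toPerm w x) (e x))

  ind-≃ : ∀ {w w′} → w ≃ w′ → ∀ π → ind w π ≡ ind w′ π
  ind-≃ {w} {w′} w≃w′ π = ind-⇔ w w′ π π
    (mk⇔ (λ c x y → Linked-edges (edgesʳ w≃w′) (c x y)) (λ c x y → Linked-edges (edgesˡ w≃w′) (c x y)))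
    (mk⇔ (λ e x → ≡.trans (≡.sym (run-≡ w≃w′ x)) (e x)) (λ e x → ≡.trans (run-≡ w≃w′ x) (e x)))

  -- Transitivity is not multiplicative, so words are counted inside every context l · _ · r:
  -- this is what makes ≋ a congruence for _⊗_.
  count : WordSum → Word n → Word n → Sym n → ℕ
  count E l r π = ∑ E (λ w → ind (l ++ w ++ r) π)

  infix 4 _≋_
  record _≋_ (E F : WordSum) : Set where
    constructor mk≋
    field count-≡ : ∀ l r π → count E l r π ≡ count F l r π
  open _≋_ public

  ≋-isEquivalence : IsEquivalence _≋_
  ≋-isEquivalence = record
    { refl  = mk≋ λ l r π → refl
    ; sym   = λ E≋F → mk≋ λ l r π → ≡.sym (count-≡ E≋F l r π)
    ; trans = λ E≋F F≋G → mk≋ λ l r π → ≡.trans (count-≡ E≋F l r π) (count-≡ F≋G l r π)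
    }

  ≋-reflexive : ∀ {E F} → E ≡ F → E ≋ F
  ≋-reflexive refl = mk≋ λ l r π → refl

  ≃⇒≋ : ∀ {w w′} → w ≃ w′ → w ∷ [] ≋ w′ ∷ []
  ≃⇒≋ w≃w′ = mk≋ λ l r π → cong (_+ 0) (ind-≃ (≃-context w≃w′ l r) π)

  monomialCount : Vec ℕ n → Sym n → ℕ
  monomialCount α π = count (monoWords n α) [] [] π

  count-++ : ∀ E F l r π → count (E ++ F) l r π ≡ count E l r π + count F l r π
  count-++ E F l r π = ∑-++ E F _

  count-letters : ∀ L l r π → count (letters L) l r π ≡ ∑ L (λ t → ind (l ++ t ∷ r) π)
  count-letters L l r π = ∑-map (_∷ []) L _

  count-⊗ˡ : ∀ E F l r π → count (E ⊗ F) l r π ≡ ∑ E (λ u → count F (l ++ u) r π)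
  count-⊗ˡ E F l r π = ≡.trans (∑-concatMap (λ u → map (u ++_) F) E _) (∑-cong E λ u →
    ≡.trans (∑-map (u ++_) F _) (∑-cong F λ v →
      cong (λ z → ind z π) (≡.trans (cong (l ++_) (++-assoc u v r)) (≡.sym (++-assoc l u (v ++ r))))))

  count-⊗ʳ : ∀ E F l r π → count (E ⊗ F) l r π ≡ ∑ F (λ v → count E l (v ++ r) π)
  count-⊗ʳ E F l r π = ≡.trans (count-⊗ˡ E F l r π) (≡.trans (∑-comm E F _) (∑-cong F λ v → ∑-cong E λ u →
    cong (λ z → ind z π) (++-assoc l u (v ++ r))))

  ε : WordSum
  ε = [] ∷ []

  ++-cong : ∀ {E E′ F F′} → E ≋ E′ → F ≋ F′ → E ++ F ≋ E′ ++ F′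
  ++-cong {E} {E′} {F} {F′} E≋E′ F≋F′ = mk≋ λ l r π → begin
    count (E ++ F) l r π             ≡⟨ count-++ E F l r π ⟩
    count E l r π + count F l r π    ≡⟨ cong₂ _+_ (count-≡ E≋E′ l r π) (count-≡ F≋F′ l r π) ⟩
    count E′ l r π + count F′ l r π  ≡⟨ count-++ E′ F′ l r π ⟨
    count (E′ ++ F′) l r π           ∎
    where open ≡.≡-Reasoning

  ++-comm : ∀ E F → E ++ F ≋ F ++ E
  ++-comm E F = mk≋ λ l r π → begin
    count (E ++ F) l r π           ≡⟨ count-++ E F l r π ⟩
    count E l r π + count F l r π  ≡⟨ ℕ.+-comm (count E l r π) (count F l r π) ⟩
    count F l r π + count E l r π  ≡⟨ count-++ F E l r π ⟨
    count (F ++ E) l r π           ∎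
    where open ≡.≡-Reasoning

  ++-cancelʳ : RightCancellative _≋_ _++_
  ++-cancelʳ G E F E+G≋F+G = mk≋ λ l r π → ℕ.+-cancelʳ-≡ (count G l r π) _ _
    (≡.trans (≡.sym (count-++ E G l r π)) (≡.trans (count-≡ E+G≋F+G l r π) (count-++ F G l r π)))

  ⊗-cong : ∀ {E E′ F F′} → E ≋ E′ → F ≋ F′ → E ⊗ F ≋ E′ ⊗ F′
  ⊗-cong {E} {E′} {F} {F′} E≋E′ F≋F′ = mk≋ λ l r π → begin
    count (E ⊗ F) l r π                 ≡⟨ count-⊗ʳ E F l r π ⟩
    ∑ F (λ v → count E l (v ++ r) π)    ≡⟨ ∑-cong F (λ v → count-≡ E≋E′ l (v ++ r) π) ⟩
    ∑ F (λ v → count E′ l (v ++ r) π)   ≡⟨ count-⊗ʳ E′ F l r π ⟨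
    count (E′ ⊗ F) l r π                ≡⟨ count-⊗ˡ E′ F l r π ⟩
    ∑ E′ (λ u → count F (l ++ u) r π)   ≡⟨ ∑-cong E′ (λ u → count-≡ F≋F′ (l ++ u) r π) ⟩
    ∑ E′ (λ u → count F′ (l ++ u) r π)  ≡⟨ count-⊗ˡ E′ F′ l r π ⟨
    count (E′ ⊗ F′) l r π               ∎
    where open ≡.≡-Reasoning

  ⊗-assoc : ∀ E F G → (E ⊗ F) ⊗ G ≋ E ⊗ (F ⊗ G)
  ⊗-assoc E F G = mk≋ λ l r π → begin
    count ((E ⊗ F) ⊗ G) l r π
      ≡⟨ count-⊗ˡ (E ⊗ F) G l r π ⟩
    ∑ (E ⊗ F) (λ w → count G (l ++ w) r π)
      ≡⟨ ∑-concatMap _ E _ ⟩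
    ∑ E (λ u → ∑ (map (u ++_) F) (λ w → count G (l ++ w) r π))
      ≡⟨ ∑-cong E (λ u → ≡.trans (∑-map (u ++_) F _)
                                 (∑-cong F λ v → cong (λ z → count G z r π) (≡.sym (++-assoc l u v)))) ⟩
    ∑ E (λ u → ∑ F (λ v → count G ((l ++ u) ++ v) r π))
      ≡⟨ ∑-cong E (λ u → count-⊗ˡ F G (l ++ u) r π) ⟨
    ∑ E (λ u → count (F ⊗ G) (l ++ u) r π)
      ≡⟨ count-⊗ˡ E (F ⊗ G) l r π ⟨
    count (E ⊗ (F ⊗ G)) l r π ∎
    where open ≡.≡-Reasoning

  ⊗-identityˡ : ∀ E → ε ⊗ E ≋ E
  ⊗-identityˡ E = mk≋ λ l r π →
    ≡.trans (count-⊗ˡ ε E l r π) (≡.trans (ℕ.+-identityʳ _) (cong (λ z → count E z r π) (++-identityʳ l)))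

  ⊗-identityʳ : ∀ E → E ⊗ ε ≋ E
  ⊗-identityʳ E = mk≋ λ l r π → ≡.trans (count-⊗ʳ E ε l r π) (ℕ.+-identityʳ _)

  ⊗-distribˡ-++ : ∀ E F G → E ⊗ (F ++ G) ≋ E ⊗ F ++ E ⊗ G
  ⊗-distribˡ-++ E F G = mk≋ λ l r π → begin
    count (E ⊗ (F ++ G)) l r π
      ≡⟨ count-⊗ˡ E (F ++ G) l r π ⟩
    ∑ E (λ u → count (F ++ G) (l ++ u) r π)
      ≡⟨ ∑-cong E (λ u → count-++ F G (l ++ u) r π) ⟩
    ∑ E (λ u → count F (l ++ u) r π + count G (l ++ u) r π)
      ≡⟨ ∑-distrib-+ E _ _ ⟩
    ∑ E (λ u → count F (l ++ u) r π) + ∑ E (λ u → count G (l ++ u) r π)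
      ≡⟨ cong₂ _+_ (count-⊗ˡ E F l r π) (count-⊗ˡ E G l r π) ⟨
    count (E ⊗ F) l r π + count (E ⊗ G) l r π
      ≡⟨ count-++ (E ⊗ F) (E ⊗ G) l r π ⟨
    count (E ⊗ F ++ E ⊗ G) l r π ∎
    where open ≡.≡-Reasoning

  ⊗-distribʳ-++ : ∀ E F G → (F ++ G) ⊗ E ≋ F ⊗ E ++ G ⊗ E
  ⊗-distribʳ-++ E F G = ≋-reflexive (concatMap-++ (λ u → map (u ++_) E) F G)

  ⊗-zeroʳ : ∀ E → E ⊗ [] ≋ []
  ⊗-zeroʳ E = mk≋ λ l r π → ≡.trans (count-⊗ˡ E [] l r π) (∑-zero E)

  wordSemiring : Semiring 0ℓ 0ℓ
  wordSemiring = record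
    { Carrier = WordSum
    ; _≈_ = _≋_
    ; _+_ = _++_
    ; _*_ = _⊗_
    ; 0# = []
    ; 1# = ε
    ; isSemiring = record
      { isSemiringWithoutAnnihilatingZero = record
        { +-isCommutativeMonoid = record
          { isMonoid = record
            { isSemigroup = record
              { isMagma = record { isEquivalence = ≋-isEquivalence ; ∙-cong = ++-cong }
              ; assoc   = λ E F G → ≋-reflexive (++-assoc E F G)
              }
            ; identity = (λ E → ≋-reflexive refl) , (λ E → ≋-reflexive (++-identityʳ E))
            }
          ; comm = ++-comm
          }
        ; *-cong     = ⊗-cong
        ; *-assoc    = ⊗-assoc
        ; *-identity = ⊗-identityˡ , ⊗-identityʳ
        ; distrib    = ⊗-distribˡ-++ , ⊗-distribʳ-++
        }
      ; zero = (λ E → ≋-reflexive refl) , ⊗-zeroʳ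
      }
    }

module Conjugation {n : ℕ} (dec : ∀ S → Dec (ActsTransitively n S))
                   (σ : Sym n) (σ-involutive : ∀ x → σ ⟨$⟩ʳ (σ ⟨$⟩ʳ x) ≡ x) where
  open Counting dec
  open ListSum ℕ.+-0-commutativeMonoid using (∑-map; ∑-cong)

  private
    s : Fin n → Fin n
    s = σ ⟨$⟩ʳ_

    s-injective : ∀ {a b} → s a ≡ s b → a ≡ b
    s-injective {a} {b} e = ≡.trans (≡.sym (σ-involutive a)) (≡.trans (cong s e) (σ-involutive b))

  conjᵗ : Transp n → Transp n
  conjᵗ t = s (proj₁ t) , s (proj₂ t)

  conjʷ : Word n → Word n
  conjʷ = map conjᵗ

  conj : WordSum → WordSum
  conj = map conjʷ

  conjʷ-involutive : ∀ w → conjʷ (conjʷ w) ≡ w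
  conjʷ-involutive []      = refl
  conjʷ-involutive (t ∷ w) = cong₂ _∷_ (cong₂ _,_ (σ-involutive _) (σ-involutive _)) (conjʷ-involutive w)

  conj-⊗ : ∀ E F → conj (E ⊗ F) ≡ conj E ⊗ conj F
  conj-⊗ []      F = refl
  conj-⊗ (u ∷ E) F = ≡.trans (map-++ conjʷ (map (u ++_) F) (E ⊗ F)) (cong₂ _++_ (prefix F) (conj-⊗ E F))
    where
    prefix : ∀ G → conj (map (u ++_) G) ≡ map (conjʷ u ++_) (conj G)
    prefix []      = refl
    prefix (v ∷ G) = cong₂ _∷_ (map-++ conjᵗ u v) (prefix G)

  conj-letters : ∀ L → conj (letters L) ≡ letters (map conjᵗ L)
  conj-letters []      = refl
  conj-letters (t ∷ L) = cong ((conjᵗ t ∷ []) ∷_) (conj-letters L)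

  Linked-conj : ∀ {w x y} → Linked w x y → Linked (conjʷ w) (s x) (s y)
  Linked-conj here = here
  Linked-conj (step {y = y} {t} x~y t∈w) =
    Linked-≡ (step (Linked-conj x~y) (∈-map⁺ conjᵗ t∈w)) (τ-conj s s-injective (proj₁ t) (proj₂ t) y)

  run-conj : ∀ w x → run (conjʷ w) (s x) ≡ s (run w x)
  run-conj []      x = refl
  run-conj (t ∷ w) x = ≡.trans (cong (run (conjʷ w)) (τ-conj s s-injective (proj₁ t) (proj₂ t) x))
                               (run-conj w (act t x))

  connects-conj : ∀ w → Connects (conjʷ w) ⇔ Connects w
  connects-conj w =
    mk⇔ (λ c x y → resolve (conjʷ-involutive w) (σ-involutive x) (σ-involutive y) (Linked-conj (c (s x) (s y))))
        (λ c x y → resolve refl (σ-involutive x) (σ-involutive y) (Linked-conj (c (s x) (s y))))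
    where
    resolve : ∀ {w w′ x x′ y y′} → w ≡ w′ → x ≡ x′ → y ≡ y′ → Linked w x y → Linked w′ x′ y′
    resolve refl refl refl x~y = x~y

  ind-conj : ∀ w π → ind (conjʷ w) π ≡ ind w (σ ∘ₚ π ∘ₚ σ)
  ind-conj w π = ind-⇔ (conjʷ w) w π (σ ∘ₚ π ∘ₚ σ) (connects-conj w) (mk⇔ to from)
    where
    open ≡.≡-Reasoning
    to : (∀ x → run (conjʷ w) x ≡ π ⟨$⟩ʳ x) → ∀ x → run w x ≡ s (π ⟨$⟩ʳ s x)
    to e x = begin
      run w x                   ≡⟨ σ-involutive _ ⟨
      s (s (run w x))           ≡⟨ cong s (run-conj w x) ⟨
      s (run (conjʷ w) (s x))   ≡⟨ cong s (e (s x)) ⟩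
      s (π ⟨$⟩ʳ s x)            ∎
    from : (∀ x → run w x ≡ s (π ⟨$⟩ʳ s x)) → ∀ x → run (conjʷ w) x ≡ π ⟨$⟩ʳ x
    from e x = begin
      run (conjʷ w) x           ≡⟨ cong (run (conjʷ w)) (σ-involutive x) ⟨
      run (conjʷ w) (s (s x))   ≡⟨ run-conj w (s x) ⟩
      s (run w (s x))           ≡⟨ cong s (e (s x)) ⟩
      s (s (π ⟨$⟩ʳ s (s x)))    ≡⟨ σ-involutive _ ⟩
      π ⟨$⟩ʳ s (s x)            ≡⟨ cong (π ⟨$⟩ʳ_) (σ-involutive x) ⟩
      π ⟨$⟩ʳ x                  ∎

  count-conj : ∀ E l r π → count (conj E) l r π ≡ count E (conjʷ l) (conjʷ r) (σ ∘ₚ π ∘ₚ σ)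
  count-conj E l r π = ≡.trans (∑-map conjʷ E _) (∑-cong E λ w →
    ≡.trans (cong (λ z → ind z π) (≡.sym (conjʷ-context w))) (ind-conj (conjʷ l ++ w ++ conjʷ r) π))
    where
    conjʷ-context : ∀ w → conjʷ (conjʷ l ++ w ++ conjʷ r) ≡ l ++ conjʷ w ++ r
    conjʷ-context w = ≡.trans (map-++ conjᵗ (conjʷ l) (w ++ conjʷ r))
      (cong₂ _++_ (conjʷ-involutive l)
                  (≡.trans (map-++ conjᵗ w (conjʷ r)) (cong (conjʷ w ++_) (conjʷ-involutive r))))

  conj-≋ : ∀ {E F} → E ≋ F → conj E ≋ conj F
  conj-≋ {E} {F} E≋F = mk≋ λ l r π → begin
    count (conj E) l r π                              ≡⟨ count-conj E l r π ⟩
    count E (conjʷ l) (conjʷ r) (σ ∘ₚ π ∘ₚ σ)         ≡⟨ count-≡ E≋F (conjʷ l) (conjʷ r) (σ ∘ₚ π ∘ₚ σ) ⟩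
    count F (conjʷ l) (conjʷ r) (σ ∘ₚ π ∘ₚ σ)         ≡⟨ count-conj F l r π ⟨
    count (conj F) l r π                              ∎
    where open ≡.≡-Reasoning

-- Commuting pairs in a semiring

module CommutingPairs {c ℓ} (S : Semiring c ℓ)
                      (+-cancelʳ : RightCancellative (Semiring._≈_ S) (Semiring._+_ S)) where
  open Semiring S renaming (refl to ≈-refl)
  open Exp S using (_^_; ^-homo-*; ^-congˡ)
  open CommutativeMonoidSolver +-commutativeMonoid using (solve; _⊕_; _⊜_)
  open import Relation.Binary.Reasoning.Setoid setoid

  Commute : Carrier → Carrier → Set ℓ
  Commute x y = x * y ≈ y * x

  ^-commute : ∀ {x y} → Commute x y → ∀ m → Commute (x ^ m) y
  ^-commute {x} {y} xy≈yx zero    = trans (*-identityˡ y) (sym (*-identityʳ y))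
  ^-commute {x} {y} xy≈yx (suc m) = begin
    (x * x ^ m) * y   ≈⟨ *-assoc x (x ^ m) y ⟩
    x * (x ^ m * y)   ≈⟨ *-congˡ (^-commute xy≈yx m) ⟩
    x * (y * x ^ m)   ≈⟨ *-assoc x y (x ^ m) ⟨
    (x * y) * x ^ m   ≈⟨ *-congʳ xy≈yx ⟩
    (y * x) * x ^ m   ≈⟨ *-assoc y x (x ^ m) ⟩
    y * (x * x ^ m)   ∎

  ^-commute-^ : ∀ {x y} → Commute x y → ∀ m k → Commute (x ^ m) (y ^ k)
  ^-commute-^ xy≈yx m k = sym (^-commute (sym (^-commute xy≈yx m)) k)

  ^-distrib-* : ∀ {x y} → Commute x y → ∀ m → (x * y) ^ m ≈ x ^ m * y ^ m
  ^-distrib-* {x} {y} xy≈yx zero    = sym (*-identityˡ 1#)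
  ^-distrib-* {x} {y} xy≈yx (suc m) = begin
    (x * y) * (x * y) ^ m     ≈⟨ *-congˡ (^-distrib-* xy≈yx m) ⟩
    (x * y) * (x ^ m * y ^ m) ≈⟨ *-assoc x y _ ⟩
    x * (y * (x ^ m * y ^ m)) ≈⟨ *-congˡ (*-assoc y (x ^ m) (y ^ m)) ⟨
    x * ((y * x ^ m) * y ^ m) ≈⟨ *-congˡ (*-congʳ (^-commute xy≈yx m)) ⟨
    x * ((x ^ m * y) * y ^ m) ≈⟨ *-congˡ (*-assoc (x ^ m) y (y ^ m)) ⟩
    x * (x ^ m * (y * y ^ m)) ≈⟨ *-assoc x (x ^ m) _ ⟨
    (x * x ^ m) * (y * y ^ m) ∎

  powerSum : Carrier → Carrier → ℕ → Carrier
  powerSum x y m = x ^ m + y ^ m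

  powerSum-recurrence : ∀ {x y} → Commute x y → ∀ m →
                        powerSum x y (suc (suc m)) + (x * y) * powerSum x y m ≈ (x + y) * powerSum x y (suc m)
  powerSum-recurrence {x} {y} xy≈yx m = begin
    (x ^ 2+m + y ^ 2+m) + (x * y) * (x ^ m + y ^ m)
      ≈⟨ +-congˡ (distribˡ (x * y) (x ^ m) (y ^ m)) ⟩
    (x ^ 2+m + y ^ 2+m) + ((x * y) * x ^ m + (x * y) * y ^ m)
      ≈⟨ +-congˡ (+-cong (trans (*-congʳ xy≈yx) (*-assoc y x (x ^ m))) (*-assoc x y (y ^ m))) ⟩
    (x ^ 2+m + y ^ 2+m) + (y * x ^ suc m + x * y ^ suc m)
      ≈⟨ solve 4 (λ a b c d → (a ⊕ d) ⊕ (c ⊕ b) ⊜ (a ⊕ b) ⊕ (c ⊕ d)) ≈-refl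
                 (x ^ 2+m) (x * y ^ suc m) (y * x ^ suc m) (y ^ 2+m) ⟩
    (x * x ^ suc m + x * y ^ suc m) + (y * x ^ suc m + y * y ^ suc m)
      ≈⟨ +-cong (distribˡ x _ _) (distribˡ y _ _) ⟨
    x * powerSum x y (suc m) + y * powerSum x y (suc m)
      ≈⟨ distribʳ _ x y ⟨
    (x + y) * powerSum x y (suc m) ∎
    where 2+m = suc (suc m)

  symmetrized : Carrier → Carrier → ℕ → ℕ → Carrier
  symmetrized x y i j = x ^ i * y ^ j + x ^ j * y ^ i

  symmetrized-comm : ∀ x y i j → symmetrized x y i j ≈ symmetrized x y j i
  symmetrized-comm x y i j = +-comm _ _

  symmetrized-factor : ∀ {x y} → Commute x y → ∀ i d →
                       symmetrized x y i (i ℕ.+ d) ≈ (x * y) ^ i * powerSum y x d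
  symmetrized-factor {x} {y} xy≈yx i d = begin
    x ^ i * y ^ (i ℕ.+ d) + x ^ (i ℕ.+ d) * y ^ i
      ≈⟨ +-cong (*-congˡ (^-homo-* y i d)) (*-congʳ (^-homo-* x i d)) ⟩
    x ^ i * (y ^ i * y ^ d) + (x ^ i * x ^ d) * y ^ i
      ≈⟨ +-cong (*-assoc _ _ _) (trans (*-congˡ (sym (^-commute-^ xy≈yx d i))) (sym (*-assoc _ _ _))) ⟨
    (x ^ i * y ^ i) * y ^ d + x ^ i * (y ^ i * x ^ d)
      ≈⟨ +-congˡ (*-assoc _ _ _) ⟨
    (x ^ i * y ^ i) * y ^ d + (x ^ i * y ^ i) * x ^ d
      ≈⟨ distribˡ _ _ _ ⟨
    (x ^ i * y ^ i) * powerSum y x d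
      ≈⟨ *-congʳ (^-distrib-* xy≈yx i) ⟨
    (x * y) ^ i * powerSum y x d ∎

  module _ {a b x y} (ab≈ba : Commute a b) (xy≈yx : Commute x y)
           (a+b≈x+y : a + b ≈ x + y) (ab≈xy : a * b ≈ x * y) where

    powerSum-cong : ∀ m → powerSum a b m ≈ powerSum x y m
    powerSum-cong m = proj₁ (consecutive m)
      where
      first : powerSum a b 1 ≈ powerSum x y 1
      first = begin
        a * 1# + b * 1#  ≈⟨ +-cong (*-identityʳ a) (*-identityʳ b) ⟩
        a + b            ≈⟨ a+b≈x+y ⟩
        x + y            ≈⟨ +-cong (*-identityʳ x) (*-identityʳ y) ⟨
        x * 1# + y * 1#  ∎
      consecutive : ∀ m → powerSum a b m ≈ powerSum x y m × powerSum a b (suc m) ≈ powerSum x y (suc m)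
      consecutive zero    = ≈-refl , first
      consecutive (suc m) with consecutive m
      ... | pₘ , pₘ₊₁ = pₘ₊₁ , +-cancelʳ ((a * b) * powerSum a b m) _ _ (begin
        powerSum a b (suc (suc m)) + (a * b) * powerSum a b m  ≈⟨ powerSum-recurrence ab≈ba m ⟩
        (a + b) * powerSum a b (suc m)                         ≈⟨ *-cong a+b≈x+y pₘ₊₁ ⟩
        (x + y) * powerSum x y (suc m)                         ≈⟨ powerSum-recurrence xy≈yx m ⟨
        powerSum x y (suc (suc m)) + (x * y) * powerSum x y m  ≈⟨ +-congˡ (*-cong ab≈xy pₘ) ⟨
        powerSum x y (suc (suc m)) + (a * b) * powerSum a b m  ∎)

    symmetrized-cong-+ : ∀ i d → symmetrized a b i (i ℕ.+ d) ≈ symmetrized x y i (i ℕ.+ d)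
    symmetrized-cong-+ i d = begin
      symmetrized a b i (i ℕ.+ d)    ≈⟨ symmetrized-factor ab≈ba i d ⟩
      (a * b) ^ i * powerSum b a d   ≈⟨ *-cong (^-congˡ i ab≈xy) (trans (+-comm _ _) (trans (powerSum-cong d) (+-comm _ _))) ⟩
      (x * y) ^ i * powerSum y x d   ≈⟨ symmetrized-factor xy≈yx i d ⟨
      symmetrized x y i (i ℕ.+ d)    ∎

    symmetrized-cong : ∀ i j → symmetrized a b i j ≈ symmetrized x y i j
    symmetrized-cong i j with ℕ.≤-total i j
    ... | inj₁ i≤j = ≡.subst (λ j → symmetrized a b i j ≈ symmetrized x y i j)
                             (ℕ.m+[n∸m]≡n i≤j) (symmetrized-cong-+ i (j ∸ i))
    ... | inj₂ j≤i = trans (symmetrized-comm a b i j)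
                           (trans (≡.subst (λ i → symmetrized a b j i ≈ symmetrized x y j i)
                                           (ℕ.m+[n∸m]≡n j≤i) (symmetrized-cong-+ j (i ∸ j)))
                                  (symmetrized-comm x y j i))


-- Jucys–Murphy elements at an adjacent pair

below : ∀ {n} → Fin n → List (Fin n)
below k = filter (λ i → toℕ i ℕ.<? toℕ k) (allFin _)

record AdjacentSplit {n} (p q : Fin n) : Set where
  field
    before after : List (Fin n)
    allFin-≡     : allFin n ≡ before ++ p ∷ q ∷ after
    before-<     : All (λ k → toℕ k < toℕ p) before
    after->      : All (λ k → toℕ q < toℕ k) after

adjacentSplit : ∀ {n} (p q : Fin n) → Adjacent p q → AdjacentSplit p q
adjacentSplit {suc (suc n)} zero (suc zero) refl = record
  { before = [] ; after = List.tabulate (λ i → suc (suc i)) ; allFin-≡ = refl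
  ; before-< = [] ; after-> = tabulate⁺ (λ _ → s≤s (s≤s z≤n)) }
adjacentSplit (suc p) (suc q) p~q with adjacentSplit p q (ℕ.suc-injective p~q)
... | split = record
  { before   = zero ∷ map suc before
  ; after    = map suc after
  ; allFin-≡ = cong (zero ∷_) (≡.trans (≡.sym (map-tabulate (λ i → i) suc))
                                       (≡.trans (cong (map suc) allFin-≡) (map-++ suc before _)))
  ; before-< = s≤s z≤n ∷ map⁺ (All.map s≤s before-<)
  ; after->  = map⁺ (All.map s≤s after->)
  }
  where open AdjacentSplit split

module _ {n : ℕ} where
  open ListSum ℕ.+-0-commutativeMonoid

  ∈-below⁻ : ∀ {c k : Fin n} → c ∈ below k → toℕ c < toℕ k
  ∈-below⁻ {k = k} c∈ = proj₂ (∈-filter⁻ (λ i → toℕ i ℕ.<? toℕ k) {xs = allFin n} c∈)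

  ∑-below-transpose : ∀ (k a b : Fin n) → (toℕ a < toℕ k ⇔ toℕ b < toℕ k) → (h : Fin n → ℕ) →
                      ∑ (below k) (h ∘ τ a b) ≡ ∑ (below k) h
  ∑-below-transpose k a b a⇔b h = begin
    ∑ (below k) (h ∘ τ a b)
      ≡⟨ ∑-filter _<k? (allFin n) _ ⟩
    ∑ (allFin n) (λ c → if does (c <k?) then h (τ a b c) else 0)
      ≡⟨ ∑-cong (allFin n) (λ c → cong (λ β → if β then h (τ a b c) else 0) (<k-τ c)) ⟩
    ∑ (allFin n) (λ c → if does (τ a b c <k?) then h (τ a b c) else 0)
      ≡⟨ ∑-allFin-permute (transpose a b) _ ⟩
    ∑ (allFin n) (λ c → if does (c <k?) then h c else 0)
      ≡⟨ ∑-filter _<k? (allFin n) _ ⟨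
    ∑ (below k) h ∎
    where
    open ≡.≡-Reasoning
    _<k? : ∀ c → Dec (toℕ c < toℕ k)
    c <k? = toℕ c ℕ.<? toℕ k
    <k-τ : ∀ c → does (c <k?) ≡ does (τ a b c <k?)
    <k-τ c with transpositionView a b c
    ... | at-u refl   rewrite τ-matchˡ a b = does-⇔ a⇔b (a <k?) (b <k?)
    ... | at-v _ refl rewrite τ-matchʳ a b = does-⇔ (⇔-sym a⇔b) (b <k?) (a <k?)
    ... | fixed c≢a c≢b = cong (λ z → does (z <k?)) (≡.sym (τ-fix c≢a c≢b))

module AdjacentJM {n : ℕ} (dec : ∀ S → Dec (ActsTransitively n S)) (p q : Fin n) (p~q : Adjacent p q) where
  open Counting dec
  open Conjugation dec (transpose p q) (τ-involutive p q)
  open ListSum ℕ.+-0-commutativeMonoid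
  open import Data.Nat using (_+_)
  open AdjacentSplit (adjacentSplit p q p~q)

  J : Fin n → WordSum
  J k = letters (JM n k)

  transposition : Fin n → Fin n → WordSum
  transposition a b = ((a , b) ∷ []) ∷ []

  p<q : toℕ p < toℕ q
  p<q = ℕ.≤-reflexive (≡.sym p~q)

  p≢q : p ≢ q
  p≢q refl = ℕ.<-irrefl refl p<q

  <p⇒≢p : ∀ {a} → toℕ a < toℕ p → a ≢ p
  <p⇒≢p a<p refl = ℕ.<-irrefl refl a<p

  <p⇒≢q : ∀ {a} → toℕ a < toℕ p → a ≢ q
  <p⇒≢q a<p refl = ℕ.<-asym a<p p<q

  <p⇒fixed : ∀ {a} → toℕ a < toℕ p → τ p q a ≡ a
  <p⇒fixed a<p = τ-fix (<p⇒≢p a<p) (<p⇒≢q a<p)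

  after-≮ : ∀ {k : Fin n} → toℕ k ≤ toℕ q → All (λ c → ¬ toℕ c < toℕ k) after
  after-≮ k≤q = All.map (λ q<c c<k → ℕ.<-irrefl refl (ℕ.<-≤-trans (ℕ.<-trans q<c c<k) k≤q)) after->

  below-p : below p ≡ before
  below-p = begin
    filter _<p? (allFin n)
      ≡⟨ cong (filter _<p?) allFin-≡ ⟩
    filter _<p? (before ++ p ∷ q ∷ after)
      ≡⟨ filter-++ _<p? before _ ⟩
    filter _<p? before ++ filter _<p? (p ∷ q ∷ after)
      ≡⟨ cong₂ _++_ (filter-all _<p? before-<) (filter-none _<p? rest) ⟩
    before ++ []
      ≡⟨ ++-identityʳ before ⟩
    before ∎
    where
    open ≡.≡-Reasoning
    _<p? : ∀ c → Dec (toℕ c < toℕ p)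
    c <p? = toℕ c ℕ.<? toℕ p
    rest : All (λ c → ¬ toℕ c < toℕ p) (p ∷ q ∷ after)
    rest = ℕ.<-irrefl refl ∷ ℕ.<-asym p<q ∷ after-≮ (ℕ.<⇒≤ p<q)

  below-q : below q ≡ before ++ p ∷ []
  below-q = begin
    filter _<q? (allFin n)
      ≡⟨ cong (filter _<q?) allFin-≡ ⟩
    filter _<q? (before ++ p ∷ q ∷ after)
      ≡⟨ filter-++ _<q? before _ ⟩
    filter _<q? before ++ filter _<q? (p ∷ q ∷ after)
      ≡⟨ cong₂ _++_ (filter-all _<q? (All.map (λ c<p → ℕ.<-trans c<p p<q) before-<))
                    (≡.trans (filter-accept _<q? p<q) (cong (p ∷_) (filter-none _<q? rest))) ⟩
    before ++ p ∷ [] ∎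
    where
    open ≡.≡-Reasoning
    _<q? : ∀ c → Dec (toℕ c < toℕ q)
    c <q? = toℕ c ℕ.<? toℕ q
    rest : All (λ c → ¬ toℕ c < toℕ q) (q ∷ after)
    rest = ℕ.<-irrefl refl ∷ after-≮ ℕ.≤-refl

  count-J : ∀ k l r π → count (J k) l r π ≡ ∑ (below k) (λ c → ind (l ++ (c , k) ∷ r) π)
  count-J k l r π = ≡.trans (count-letters (JM n k) l r π) (∑-map _ (below k) _)

  count-J⊗J : ∀ j k l r π → count (J j ⊗ J k) l r π ≡
              ∑ (below j) (λ a → ∑ (below k) (λ c → ind (l ++ (a , j) ∷ (c , k) ∷ r) π))
  count-J⊗J j k l r π = begin
    count (J j ⊗ J k) l r π
      ≡⟨ count-⊗ˡ (J j) (J k) l r π ⟩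
    ∑ (J j) (λ u → count (J k) (l ++ u) r π)
      ≡⟨ ≡.trans (∑-map _ (JM n j) _) (∑-map _ (below j) _) ⟩
    ∑ (below j) (λ a → count (J k) (l ++ (a , j) ∷ []) r π)
      ≡⟨ ∑-cong (below j) (λ a → ≡.trans (count-J k _ r π)
                                         (∑-cong (below k) λ c → cong (λ z → ind z π) (++-assoc l _ _))) ⟩
    ∑ (below j) (λ a → ∑ (below k) (λ c → ind (l ++ (a , j) ∷ (c , k) ∷ r) π)) ∎
    where open ≡.≡-Reasoning

  J-commute : J p ⊗ J q ≋ J q ⊗ J p
  J-commute = mk≋ λ l r π → begin
    count (J p ⊗ J q) l r π
      ≡⟨ count-J⊗J p q l r π ⟩
    ∑ (below p) (λ a → ∑ (below q) (λ c → ind (l ++ (a , p) ∷ (c , q) ∷ r) π))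
      ≡⟨ ∑-cong-∈ (below p) (λ a∈ → slide-sum l r π (∈-below⁻ a∈)) ⟩
    ∑ (below p) (λ a → ∑ (below q) (λ c → ind (l ++ (c , q) ∷ (a , p) ∷ r) π))
      ≡⟨ ∑-comm (below p) (below q) _ ⟩
    ∑ (below q) (λ c → ∑ (below p) (λ a → ind (l ++ (c , q) ∷ (a , p) ∷ r) π))
      ≡⟨ count-J⊗J q p l r π ⟨
    count (J q ⊗ J p) l r π ∎
    where
    open ≡.≡-Reasoning
    -- reindexing c ↦ (a p) c lets (a p) slide past (c q)
    slide-sum : ∀ l r π {a} → toℕ a < toℕ p →
                ∑ (below q) (λ c → ind (l ++ (a , p) ∷ (c , q) ∷ r) π) ≡
                ∑ (below q) (λ c → ind (l ++ (c , q) ∷ (a , p) ∷ r) π)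
    slide-sum l r π {a} a<p = ≡.trans
      (≡.sym (∑-below-transpose q a p (mk⇔ (λ _ → p<q) (λ _ → ℕ.<-trans a<p p<q))
                                (λ c → ind (l ++ (a , p) ∷ (c , q) ∷ r) π)))
      (∑-cong (below q) λ c → ind-≃ (≃-context (slide c) l r) π)
      where
      slide : ∀ c → (a , p) ∷ (τ a p c , q) ∷ [] ≃ (c , q) ∷ (a , p) ∷ []
      slide c = ≡.subst (λ z → (a , p) ∷ (τ a p c , z) ∷ [] ≃ (c , q) ∷ (a , p) ∷ [])
                        (τ-fix (λ q≡a → <p⇒≢q a<p (≡.sym q≡a)) (λ q≡p → p≢q (≡.sym q≡p)))
                        (≃-slide a p c q)

  conj-J : ∀ k → k ≢ p → k ≢ q → conj (J k) ≋ J k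
  conj-J k k≢p k≢q = mk≋ λ l r π → begin
    count (conj (J k)) l r π
      ≡⟨ cong (λ E → count E l r π) (conj-letters (JM n k)) ⟩
    count (letters (map conjᵗ (JM n k))) l r π
      ≡⟨ ≡.trans (count-letters (map conjᵗ (JM n k)) l r π) (≡.trans (∑-map conjᵗ (JM n k) _) (∑-map _ (below k) _)) ⟩
    ∑ (below k) (λ c → ind (l ++ (τ p q c , τ p q k) ∷ r) π)
      ≡⟨ ∑-cong (below k) (λ c → cong (λ z → ind (l ++ (τ p q c , z) ∷ r) π) (τ-fix k≢p k≢q)) ⟩
    ∑ (below k) (λ c → ind (l ++ (τ p q c , k) ∷ r) π)
      ≡⟨ ∑-below-transpose k p q p<k⇔q<k (λ c → ind (l ++ (c , k) ∷ r) π) ⟩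
    ∑ (below k) (λ c → ind (l ++ (c , k) ∷ r) π)
      ≡⟨ count-J k l r π ⟨
    count (J k) l r π ∎
    where
    open ≡.≡-Reasoning
    p<k⇔q<k : toℕ p < toℕ k ⇔ toℕ q < toℕ k
    p<k⇔q<k = mk⇔ (λ p<k → ℕ.≤∧≢⇒< (≡.subst (_≤ toℕ k) (≡.sym p~q) p<k) (k≢q ∘ toℕ-injective ∘ ≡.sym))
                  (ℕ.<-trans p<q)

  pairs : Fin n → WordSum
  pairs k = letters (map (_, k) before)

  J-p≡ : J p ≡ pairs p
  J-p≡ = cong (λ xs → letters (map (_, p) xs)) below-p

  J-q≡ : J q ≡ pairs q ++ transposition p q
  J-q≡ = ≡.trans (cong (λ xs → letters (map (_, q) xs)) below-q)
                 (≡.trans (cong letters (map-++ (_, q) before (p ∷ []))) (map-++ (_∷ []) (map (_, q) before) _))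

  conj-pairs : ∀ {k k′} → τ p q k ≡ k′ → map conjᵗ (map (_, k) before) ≡ map (_, k′) before
  conj-pairs {k} {k′} k↦k′ = ≡.trans (≡.sym (map-∘ before))
    (map-cong-local (All.map (λ a<p → cong₂ _,_ (<p⇒fixed a<p) k↦k′) before-<))

  conj-J-p≡ : conj (J p) ≡ pairs q
  conj-J-p≡ = ≡.trans (cong conj J-p≡) (≡.trans (conj-letters _) (cong letters (conj-pairs (τ-matchˡ p q))))

  conj-J-q≡ : conj (J q) ≡ pairs p ++ transposition q p
  conj-J-q≡ = ≡.trans (cong conj J-q≡) (≡.trans (map-++ conjʷ (pairs q) _)
                (cong₂ _++_ (≡.trans (conj-letters _) (cong letters (conj-pairs (τ-matchʳ p q))))
                            (cong (λ t → (t ∷ []) ∷ []) (cong₂ _,_ (τ-matchˡ p q) (τ-matchʳ p q)))))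

  pairs-slide : pairs q ⊗ transposition p q ≋ transposition p q ⊗ pairs p
  pairs-slide = mk≋ λ l r π → begin
    count (pairs q ⊗ transposition p q) l r π
      ≡⟨ count-⊗ʳ (pairs q) (transposition p q) l r π ⟩
    count (pairs q) l ((p , q) ∷ r) π + 0
      ≡⟨ cong (_+ 0) (≡.trans (count-letters (map (_, q) before) l ((p , q) ∷ r) π) (∑-map (_, q) before _)) ⟩
    ∑ before (λ a → ind (l ++ (a , q) ∷ (p , q) ∷ r) π) + 0
      ≡⟨ cong (_+ 0) (∑-cong-∈ before (λ a∈ → slide l r π (All.lookup before-< a∈))) ⟩
    ∑ before (λ a → ind ((l ++ (p , q) ∷ []) ++ (a , p) ∷ r) π) + 0
      ≡⟨ cong (_+ 0) (≡.trans (count-letters (map (_, p) before) (l ++ (p , q) ∷ []) r π) (∑-map (_, p) before _)) ⟨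
    count (pairs p) (l ++ (p , q) ∷ []) r π + 0
      ≡⟨ count-⊗ˡ (transposition p q) (pairs p) l r π ⟨
    count (transposition p q ⊗ pairs p) l r π ∎
    where
    open ≡.≡-Reasoning
    slide : ∀ l r π {a} → toℕ a < toℕ p →
            ind (l ++ (a , q) ∷ (p , q) ∷ r) π ≡ ind ((l ++ (p , q) ∷ []) ++ (a , p) ∷ r) π
    slide l r π {a} a<p = ≡.trans (≡.sym (ind-≃ (≃-context pq·ap≃aq·pq l r) π))
                                  (cong (λ z → ind z π) (≡.sym (++-assoc l ((p , q) ∷ []) ((a , p) ∷ r))))
      where
      pq·ap≃aq·pq : (p , q) ∷ (a , p) ∷ [] ≃ (a , q) ∷ (p , q) ∷ []
      pq·ap≃aq·pq = ≡.subst₂ (λ x y → (p , q) ∷ (x , y) ∷ [] ≃ (a , q) ∷ (p , q) ∷ [])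
                             (<p⇒fixed a<p) (τ-matchʳ p q) (≃-slide p q a q)

  flip-pq : transposition q p ≋ transposition p q
  flip-pq = ≃⇒≋ (≃-flip q p)

  open Semiring wordSemiring using (setoid; +-congˡ; *-congˡ; distribˡ; distribʳ; +-commutativeSemigroup)
  open CommSemigroupProperties +-commutativeSemigroup using (x∙yz≈y∙xz)

  conj-J-sum : conj (J p) ++ conj (J q) ≋ J p ++ J q
  conj-J-sum = begin
    conj (J p) ++ conj (J q)                         ≡⟨ cong₂ _++_ conj-J-p≡ conj-J-q≡ ⟩
    pairs q ++ (pairs p ++ transposition q p)        ≈⟨ +-congˡ {pairs q} (+-congˡ {pairs p} flip-pq) ⟩
    pairs q ++ (pairs p ++ transposition p q)        ≈⟨ x∙yz≈y∙xz (pairs q) (pairs p) _ ⟩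
    pairs p ++ (pairs q ++ transposition p q)        ≡⟨ cong₂ _++_ J-p≡ J-q≡ ⟨
    J p ++ J q                                       ∎
    where open import Relation.Binary.Reasoning.Setoid setoid

  conj-J-product : conj (J p) ⊗ conj (J q) ≋ J p ⊗ J q
  conj-J-product = begin
    conj (J p) ⊗ conj (J q)                                          ≡⟨ cong₂ _⊗_ conj-J-p≡ conj-J-q≡ ⟩
    pairs q ⊗ (pairs p ++ transposition q p)                         ≈⟨ *-congˡ {pairs q} (+-congˡ {pairs p} flip-pq) ⟩
    pairs q ⊗ (pairs p ++ transposition p q)                         ≈⟨ distribˡ (pairs q) (pairs p) _ ⟩
    pairs q ⊗ pairs p ++ pairs q ⊗ transposition p q                 ≈⟨ +-congˡ {pairs q ⊗ pairs p} pairs-slide ⟩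
    pairs q ⊗ pairs p ++ transposition p q ⊗ pairs p                 ≈⟨ distribʳ (pairs p) (pairs q) _ ⟨
    (pairs q ++ transposition p q) ⊗ pairs p                         ≡⟨ cong₂ _⊗_ J-q≡ J-p≡ ⟨
    J q ⊗ J p                                                        ≈⟨ J-commute ⟨
    J p ⊗ J q                                                        ∎
    where open import Relation.Binary.Reasoning.Setoid setoid


-- Monomials in the Jucys–Murphy elements

module AdjacentMonomials {n : ℕ} (dec : ∀ S → Dec (ActsTransitively n S)) (p q : Fin n) (p~q : Adjacent p q) where
  open Counting dec
  open Conjugation dec (transpose p q) (τ-involutive p q)
  open AdjacentJM dec p q p~q
  open AdjacentSplit (adjacentSplit p q p~q)
  open Semiring wordSemiring
    using (_+_; _*_; setoid; sym; trans; +-cong; *-cong; *-congˡ; *-congʳ; *-assoc; *-identityʳ;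
           distribˡ; distribʳ; *-monoid)
    renaming (refl to ≈-refl)
  open Exp wordSemiring using (_^_; ^-congˡ; ^-homo-*)
  open ListProduct *-monoid
  open CommutingPairs wordSemiring ++-cancelʳ using (Commute; symmetrized; symmetrized-cong)
  open import Relation.Binary.Reasoning.Setoid setoid

  factor : Vec ℕ n → Fin n → WordSum
  factor α k = pow (JM n k) (lookup α k)

  pow≋^ : ∀ L m → pow L m ≋ letters L ^ m
  pow≋^ L zero    = ≈-refl
  pow≋^ L (suc m) = begin
    pow L m * letters L            ≈⟨ *-cong (pow≋^ L m) (sym (*-identityʳ (letters L))) ⟩
    letters L ^ m * letters L ^ 1  ≈⟨ ^-homo-* (letters L) m 1 ⟨
    letters L ^ (m ℕ.+ 1)          ≡⟨ cong (letters L ^_) (ℕ.+-comm m 1) ⟩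
    letters L ^ suc m              ∎

  conj-^ : ∀ E m → conj (E ^ m) ≡ conj E ^ m
  conj-^ E zero    = refl
  conj-^ E (suc m) = ≡.trans (conj-⊗ E (E ^ m)) (cong (conj E *_) (conj-^ E m))

  conj-product : ∀ ks (g : Fin n → WordSum) → conj (product ks g) ≡ product ks (conj ∘ g)
  conj-product []       g = refl
  conj-product (k ∷ ks) g = ≡.trans (conj-⊗ (g k) (product ks g)) (cong (conj (g k) *_) (conj-product ks g))

  before-≢ : ∀ {k} → k ∈ before → k ≢ p × k ≢ q
  before-≢ k∈ = <p⇒≢p (All.lookup before-< k∈) , <p⇒≢q (All.lookup before-< k∈)

  after-≢ : ∀ {k} → k ∈ after → k ≢ p × k ≢ q
  after-≢ k∈ = (λ { refl → ℕ.<-asym p<q (All.lookup after-> k∈) })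
             , (λ { refl → ℕ.<-irrefl refl (All.lookup after-> k∈) })

  conj-factor : ∀ α {k} → k ≢ p × k ≢ q → conj (factor α k) ≋ factor α k
  conj-factor α {k} (k≢p , k≢q) = begin
    conj (pow (JM n k) m)  ≈⟨ conj-≋ (pow≋^ (JM n k) m) ⟩
    conj (J k ^ m)         ≡⟨ conj-^ (J k) m ⟩
    conj (J k) ^ m         ≈⟨ ^-congˡ m (conj-J k k≢p k≢q) ⟩
    J k ^ m                ≈⟨ pow≋^ (JM n k) m ⟨
    pow (JM n k) m         ∎
    where m = lookup α k

  product-allFin-split : ∀ g → product (allFin n) g ≋ product before g * ((g p * g q) * product after g)
  product-allFin-split g = begin
    product (allFin n) g                                ≡⟨ cong (λ ks → product ks g) allFin-≡ ⟩
    product (before ++ p ∷ q ∷ after) g                 ≈⟨ product-++ before (p ∷ q ∷ after) g ⟩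
    product before g * (g p * (g q * product after g))  ≈⟨ *-congˡ {product before g} (*-assoc (g p) (g q) _) ⟨
    product before g * ((g p * g q) * product after g)  ∎

  -- the monomial J^α with its factor Jₚ^(α p) J_q^(α q) replaced by Z
  sandwich : WordSum → Vec ℕ n → WordSum
  sandwich Z α = product before (factor α) * (Z * product after (factor α))

  sandwich-cong : ∀ {Z Z′} α → Z ≋ Z′ → sandwich Z α ≋ sandwich Z′ α
  sandwich-cong α Z≋Z′ = *-congˡ {product before (factor α)} (*-congʳ {product after (factor α)} Z≋Z′)

  sandwich-+ : ∀ Z Z′ α → sandwich Z α + sandwich Z′ α ≋ sandwich (Z + Z′) α
  sandwich-+ Z Z′ α = trans (sym (distribˡ (product before (factor α)) _ _))
                            (*-congˡ {product before (factor α)} (sym (distribʳ (product after (factor α)) Z Z′)))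

  sandwich-swapAt : ∀ (Z : ℕ → ℕ → WordSum) α →
                    sandwich (Z (lookup (swapAt p q α) p) (lookup (swapAt p q α) q)) (swapAt p q α) ≋
                    sandwich (Z (lookup α q) (lookup α p)) α
  sandwich-swapAt Z α = begin
    sandwich (Z (lookup (swapAt p q α) p) (lookup (swapAt p q α) q)) (swapAt p q α)
      ≡⟨ cong₂ (λ a b → sandwich (Z a b) (swapAt p q α))
               (≡.trans (lookup-swapAt p q α p) (cong (lookup α) (τ-matchˡ p q)))
               (≡.trans (lookup-swapAt p q α q) (cong (lookup α) (τ-matchʳ p q))) ⟩
    sandwich (Z (lookup α q) (lookup α p)) (swapAt p q α)
      ≈⟨ *-cong (product-cong-∈ before (unmoved ∘ before-≢))
                (*-congˡ {Z (lookup α q) (lookup α p)} (product-cong-∈ after (unmoved ∘ after-≢))) ⟩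
    sandwich (Z (lookup α q) (lookup α p)) α ∎
    where
    unmoved : ∀ {k} → k ≢ p × k ≢ q → factor (swapAt p q α) k ≋ factor α k
    unmoved {k} (k≢p , k≢q) =
      ≋-reflexive (cong (pow (JM n k)) (≡.trans (lookup-swapAt p q α k) (cong (lookup α) (τ-fix k≢p k≢q))))

  monomial≋ : ∀ α → monoWords n α ≋ sandwich (J p ^ lookup α p * J q ^ lookup α q) α
  monomial≋ α = trans (product-allFin-split (factor α))
                      (sandwich-cong α (*-cong (pow≋^ (JM n p) (lookup α p)) (pow≋^ (JM n q) (lookup α q))))

  conj-monomial≋ : ∀ α → conj (monoWords n α) ≋ sandwich (conj (J p) ^ lookup α p * conj (J q) ^ lookup α q) α
  conj-monomial≋ α = begin
    conj (monoWords n α)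
      ≡⟨ conj-product (allFin n) (factor α) ⟩
    product (allFin n) (conj ∘ factor α)
      ≈⟨ product-allFin-split (conj ∘ factor α) ⟩
    product before (conj ∘ factor α) * ((conj (factor α p) * conj (factor α q)) * product after (conj ∘ factor α))
      ≈⟨ *-cong (product-cong-∈ before (conj-factor α ∘ before-≢))
                (*-cong (*-cong (conj-pow p) (conj-pow q)) (product-cong-∈ after (conj-factor α ∘ after-≢))) ⟩
    sandwich (conj (J p) ^ lookup α p * conj (J q) ^ lookup α q) α ∎
    where
    conj-pow : ∀ k → conj (factor α k) ≋ conj (J k) ^ lookup α k
    conj-pow k = ≡.subst (conj (factor α k) ≋_) (conj-^ (J k) (lookup α k)) (conj-≋ (pow≋^ (JM n k) (lookup α k)))

  conj-monomial-pair : ∀ α → conj (monoWords n α) + conj (monoWords n (swapAt p q α)) ≋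
                             monoWords n α + monoWords n (swapAt p q α)
  conj-monomial-pair α = begin
    conj (monoWords n α) + conj (monoWords n (swapAt p q α))
      ≈⟨ +-cong (conj-monomial≋ α)
                (trans (conj-monomial≋ (swapAt p q α)) (sandwich-swapAt (λ a b → conj (J p) ^ a * conj (J q) ^ b) α)) ⟩
    sandwich (conj (J p) ^ a * conj (J q) ^ b) α + sandwich (conj (J p) ^ b * conj (J q) ^ a) α
      ≈⟨ sandwich-+ (conj (J p) ^ a * conj (J q) ^ b) (conj (J p) ^ b * conj (J q) ^ a) α ⟩
    sandwich (symmetrized (conj (J p)) (conj (J q)) a b) α
      ≈⟨ sandwich-cong α (symmetrized-cong conj-commute J-commute conj-J-sum conj-J-product a b) ⟩
    sandwich (symmetrized (J p) (J q) a b) α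
      ≈⟨ sandwich-+ (J p ^ a * J q ^ b) (J p ^ b * J q ^ a) α ⟨
    sandwich (J p ^ a * J q ^ b) α + sandwich (J p ^ b * J q ^ a) α
      ≈⟨ +-cong (monomial≋ α) (trans (monomial≋ (swapAt p q α)) (sandwich-swapAt (λ a b → J p ^ a * J q ^ b) α)) ⟨
    monoWords n α + monoWords n (swapAt p q α) ∎
    where
    a = lookup α p
    b = lookup α q
    conj-commute : Commute (conj (J p)) (conj (J q))
    conj-commute = ≡.subst₂ _≋_ (conj-⊗ (J p) (J q)) (conj-⊗ (J q) (J p)) (conj-≋ J-commute)

  monomialCount-conj-pair : ∀ α π →
    monomialCount α (transpose p q ∘ₚ π ∘ₚ transpose p q) ℕ.+ monomialCount (swapAt p q α) (transpose p q ∘ₚ π ∘ₚ transpose p q)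
    ≡ monomialCount α π ℕ.+ monomialCount (swapAt p q α) π
  monomialCount-conj-pair α π =
    ≡.trans (≡.sym (cong₂ ℕ._+_ (count-conj M [] [] π) (count-conj M′ [] [] π)))
      (≡.trans (≡.sym (count-++ (conj M) (conj M′) [] [] π))
        (≡.trans (count-≡ (conj-monomial-pair α) [] [] π) (count-++ M M′ [] [] π)))
    where
    M = monoWords n α
    M′ = monoWords n (swapAt p q α)

-- The transitive image of a symmetric function

halve-injective : ∀ {a b} → a ℕ.+ a ≡ b ℕ.+ b → a ≡ b
halve-injective {a} {b} e = ≡.trans (ℕ.n≡⌊n+n/2⌋ a) (≡.trans (cong ⌊_/2⌋ e) (≡.sym (ℕ.n≡⌊n+n/2⌋ b)))

module TransitiveImage {c ℓ} (R : CommutativeRing c ℓ) {n : ℕ} (dec : ∀ S → Dec (ActsTransitively n S)) where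
  open CommutativeRing R renaming (Carrier to K; refl to ≈-refl)
  open Over R
  open GroupAlgebra R
  open Counting dec
  open ListSum +-commutativeMonoid
  module ℕ∑ = ListSum ℕ.+-0-commutativeMonoid
  open Mult +-monoid using (×-homo-+; ×-congʳ) renaming (_×_ to _×ₙ_)
  open import Relation.Binary.Reasoning.Setoid setoid

  ×-distrib-∑ : ∀ {a} {A : Set a} (xs : List A) (g : A → ℕ) x → ℕ∑.∑ xs g ×ₙ x ≈ ∑ xs (λ y → g y ×ₙ x)
  ×-distrib-∑ []       g x = ≈-refl
  ×-distrib-∑ (y ∷ xs) g x = trans (×-homo-+ x (g y) _) (+-congˡ (×-distrib-∑ xs g x))

  ind-× : ∀ (w : Word n) π x → ind w π ×ₙ x ≈
          (if does (dec (map toPerm w)) then (if does (prod (map toPerm w) ≟ₚ π) then x else 0#) else 0#)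
  ind-× w π x with does (dec (map toPerm w)) | does (prod (map toPerm w) ≟ₚ π)
  ... | true  | true  = +-identityʳ x
  ... | true  | false = ≈-refl
  ... | false | _     = ≈-refl

  coeffGA-T : ∀ (e : FormalSum n) π → coeffGA (T n dec e) π ≈ ∑ e (λ t → ind (proj₂ t) π ×ₙ proj₁ t)
  coeffGA-T e π = begin
    coeffGA (T n dec e) π
      ≈⟨ coeffGA≈∑ (T n dec e) π ⟩
    ∑ (map (λ t → proj₁ t , prod (map toPerm (proj₂ t))) (filter transitive? e)) (pick π)
      ≡⟨ ∑-map _ (filter transitive? e) (pick π) ⟩
    ∑ (filter transitive? e) (λ t → pick π (proj₁ t , prod (map toPerm (proj₂ t))))
      ≈⟨ ∑-filter transitive? e _ ⟩
    ∑ e (λ t → if does (transitive? t) then pick π (proj₁ t , prod (map toPerm (proj₂ t))) else 0#)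
      ≈⟨ ∑-cong e (λ t → sym (ind-× (proj₂ t) π (proj₁ t))) ⟩
    ∑ e (λ t → ind (proj₂ t) π ×ₙ proj₁ t) ∎
    where
    transitive? : ∀ (t : K × Word n) → Dec (ActsTransitively n (map toPerm (proj₂ t)))
    transitive? t = dec (map toPerm (proj₂ t))

  module _ (f : SymFun) where

    X : GA n
    X = T n dec (evalJM n f)

    κ : Vec ℕ n → K
    κ α = coeff f (toList α)

    coeffGA-evalJM : ∀ π → coeffGA X π ≈ ∑ (vecsUpTo n (degree f)) (λ α → monomialCount α π ×ₙ κ α)
    coeffGA-evalJM π = begin
      coeffGA X π
        ≈⟨ coeffGA-T (evalJM n f) π ⟩
      ∑ (evalJM n f) (λ t → ind (proj₂ t) π ×ₙ proj₁ t)
        ≈⟨ ∑-concatMap _ V _ ⟩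
      ∑ V (λ α → ∑ (map (κ α ,_) (monoWords n α)) (λ t → ind (proj₂ t) π ×ₙ proj₁ t))
        ≈⟨ ∑-cong V (λ α → reflexive (∑-map _ (monoWords n α) _)) ⟩
      ∑ V (λ α → ∑ (monoWords n α) (λ w → ind w π ×ₙ κ α))
        ≈⟨ ∑-cong V (λ α → ×-distrib-∑ (monoWords n α) (λ w → ind w π) _) ⟨
      ∑ V (λ α → ℕ∑.∑ (monoWords n α) (λ w → ind w π) ×ₙ κ α)
        ≈⟨ ∑-cong V (λ α → reflexive (cong (_×ₙ κ α) (ℕ∑.∑-cong (monoWords n α) (λ w →
             cong (λ z → ind z π) (≡.sym (++-identityʳ w)))))) ⟩
      ∑ V (λ α → monomialCount α π ×ₙ κ α) ∎
      where V = vecsUpTo n (degree f)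

    adjacent-invariant : ∀ p q → Adjacent p q → Invariant X (transpose p q)
    adjacent-invariant p q p~q π = begin
      coeffGA X (s ∘ₚ π ∘ₚ Perm.flip s)
        ≈⟨ coeffGA-resp X (s ∘ₚ π ∘ₚ Perm.flip s) ρ (λ i → τ-comm q p (π ⟨$⟩ʳ (s ⟨$⟩ʳ i))) ⟩
      coeffGA X ρ
        ≈⟨ coeffGA-evalJM ρ ⟩
      ∑ V (λ α → monomialCount α ρ ×ₙ κ α)
        ≈⟨ ∑-swapAt-invariant p q p~q (degree f) (λ α → monomialCount α ρ ×ₙ κ α) (λ α → monomialCount α π ×ₙ κ α)
                              on-orbits on-fixed ⟩
      ∑ V (λ α → monomialCount α π ×ₙ κ α)
        ≈⟨ coeffGA-evalJM π ⟨
      coeffGA X π ∎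
      where
      open ExponentSums +-commutativeMonoid using (∑-swapAt-invariant)
      open AdjacentMonomials dec p q p~q using (monomialCount-conj-pair)
      s = transpose p q
      ρ = s ∘ₚ π ∘ₚ s
      V = vecsUpTo n (degree f)
      m = monomialCount
      κ-swapAt : ∀ α → κ (swapAt p q α) ≈ κ α
      κ-swapAt α = coeff-sym f n α s
      on-orbits : ∀ α → m α ρ ×ₙ κ α + m (swapAt p q α) ρ ×ₙ κ (swapAt p q α) ≈
                        m α π ×ₙ κ α + m (swapAt p q α) π ×ₙ κ (swapAt p q α)
      on-orbits α = begin
        m α ρ ×ₙ κ α + m α′ ρ ×ₙ κ α′   ≈⟨ +-congˡ (×-congʳ (m α′ ρ) (κ-swapAt α)) ⟩
        m α ρ ×ₙ κ α + m α′ ρ ×ₙ κ α    ≈⟨ ×-homo-+ (κ α) (m α ρ) (m α′ ρ) ⟨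
        (m α ρ ℕ.+ m α′ ρ) ×ₙ κ α       ≡⟨ cong (_×ₙ κ α) (monomialCount-conj-pair α π) ⟩
        (m α π ℕ.+ m α′ π) ×ₙ κ α       ≈⟨ ×-homo-+ (κ α) (m α π) (m α′ π) ⟩
        m α π ×ₙ κ α + m α′ π ×ₙ κ α    ≈⟨ +-congˡ (×-congʳ (m α′ π) (κ-swapAt α)) ⟨
        m α π ×ₙ κ α + m α′ π ×ₙ κ α′   ∎
        where α′ = swapAt p q α
      -- α is its own partner: the pair identity reads 2a = 2b, which can be halved in ℕ but not in R
      on-fixed : ∀ α → swapAt p q α ≡ α → m α ρ ×ₙ κ α ≈ m α π ×ₙ κ α
      on-fixed α sα≡α = reflexive (cong (_×ₙ κ α) (halve-injective {m α ρ} {m α π}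
        (≡.subst (λ β → m α ρ ℕ.+ m β ρ ≡ m α π ℕ.+ m β π) sα≡α (monomialCount-conj-pair α π))))

    central : Central X
    central = classFunction⇒central X (adjacentClosed⇒all (invariant-adjacentClosed X adjacent-invariant))

theorem1p6 : ∀ {c ℓ : Level} (R : CommutativeRing c ℓ) (n : ℕ)
               (dec : ∀ S → Dec (ActsTransitively n S))
               (f : Over.SymFun R) →
               Over.Central R (Over.T R n dec (Over.evalJM R n f))
theorem1p6 R n dec f = TransitiveImage.central R dec f
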